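{- Totally order the letters by $a_1<a_2<\cdots<a_M<x_1<x_2<\cdots<x_N$. Then the labeling $\Lambda$ is an $R^*$-labeling of the poset of shuffles $W_{MN}$.
   Context: Let $\mathcal A=\{a_1,\dots,a_M\}$ (lower alphabet) and $\mathcal X=\{x_1,\dots,x_N\}$ (upper alphabet) be disjoint sets. A shuffle word is a (possibly empty) word with distinct letters from $\mathcal A\cup\mathcal X$ such that the letters from $\mathcal A$ in it appear in increasing order of subscripts, and likewise those from $\mathcal X$. The poset of shuffles $W_{MN}$ is the set of shuffle words ordered by the reflexive-transitive closure of the covering relation $w\lessdot w'$ iff $w'$ is obtained from $w$ by deleting one letter of $\mathcal A$ or inserting one letter of $\mathcal X$ (the result being a shuffle word). It has minimum $\hat0=a_1\cdots a_M$, maximum $\hat1=x_1\cdots x_N$, and maximal chains of length $M+N$. The labeling $\Lambda$: for a maximal chain $c=(\hat0=w^0\lessdot\cdots\lessdot w^{M+N}=\hat1)$ set $\Lambda(c)=(\Lambda_1(c),\dots,\Lambda_{M+N}(c))$, where for $0\le i<M+N$: (x) if $w^{i+1}$ is obtained from $w^i$ by inserting $x_k\in\mathcal X$, then $\Lambda_{i+1}(c)=x_k$; (xa) if $w^i=u\,x_k\,a_m\,v$ and $w^{i+1}=u\,x_k\,v$, and this is the first step along $c$ (from $\hat 0$) in which a letter located immediately after $x_k$ is deleted, then $\Lambda_{i+1}(c)=x_k$; (a) if $w^{i+1}$ is obtained by deleting $a_j\in\mathcal A$ and this is not of type (xa), then $\Lambda_{i+1}(c)=a_j$. A labeling $\Lambda$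 of the maximal chains of a ranked poset of rank $n$ with values in $L^n$ ($L$ totally ordered) is a $C$-labeling if for every maximal chain $c=(\hat0=w^0\lessdot\cdots\lessdot w^n=\hat1)$ and every $r$, $\Lambda_r(c)$ depends only on $w^0\lessdot\cdots\lessdot w^r$. A $C$-labeling is an $R^*$-labeling if for every chain $\hat0=w^0\lessdot w^1\lessdot\cdots\lessdot w^r<u$ there is a unique saturated chain $w^r\lessdot w^{r+1}\lessdot\cdots\lessdot w^s=u$ such that $\Lambda_{r+1}(c)<\Lambda_{r+2}(c)<\cdots<\Lambda_s(c)$, where $c$ is any maximal chain containing $w^0\lessdot\cdots\lessdot w^s$. -}

module Defs where

open import Data.Nat using (ℕ; zero; suc; _<ᵇ_; _∸_; _+_)
open import Data.Fin as Fin using (Fin)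
open import Data.List using (List; []; _∷_; _++_; map; allFin; length; take; drop)
open import Data.Bool.ListAction using (any)
open import Data.Bool using (Bool; true; false; if_then_else_)
open import Data.Maybe using (Maybe; just; nothing)
import Data.Product
open import Data.Product using (_×_; _,_; ∃; Σ)
open import Data.Sum using (_⊎_)
open import Data.Unit using (⊤)
open import Relation.Nullary using (does; ¬_; yes; no; Dec)
open import Relation.Binary.PropositionalEquality using (_≡_; _≢_; refl; cong)
open import Data.List.Relation.Unary.AllPairs using (AllPairs)
open import Data.List.Relation.Unary.Linked using (Linked)
open import Relation.Binary.Construct.Closure.ReflexiveTransitive using (Star)

module Shuffles (M N : ℕ) where

  -- letters: a i  stands for a_{i+1},  x k  stands for x_{k+1}
  data Letter : Set where
    a : Fin M → Letter
    x : Fin N → Letter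

  data _<L_ : Letter → Letter → Set where
    a<a : ∀ {i j} → i Fin.< j → a i <L a j
    a<x : ∀ {i k} → a i <L x k
    x<x : ∀ {k l} → k Fin.< l → x k <L x l

  Word : Set
  Word = List Letter

  -- two letters at positions p < q of a shuffle word: if both are in 𝒜
  -- (resp. both in 𝒳) their subscripts strictly increase (hence distinct)
  Compat : Letter → Letter → Set
  Compat (a i) (a j) = i Fin.< j
  Compat (x k) (x l) = k Fin.< l
  Compat _     _     = ⊤

  IsShuffle : Word → Set
  IsShuffle w = AllPairs Compat w

  0̂ : Word
  0̂ = map a (allFin M)

  1̂ : Word
  1̂ = map x (allFin N)

  DeleteA : Word → Word → Set
  DeleteA w w' = ∃ λ u → ∃ λ v → ∃ λ (i : Fin M) → (w ≡ u ++ a i ∷ v) × (w' ≡ u ++ v)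

  InsertX : Word → Word → Set
  InsertX w w' = ∃ λ u → ∃ λ v → ∃ λ (k : Fin N) → (w ≡ u ++ v) × (w' ≡ u ++ x k ∷ v)

  _⋖_ : Word → Word → Set
  w ⋖ w' = IsShuffle w × IsShuffle w' × (DeleteA w w' ⊎ InsertX w w')

  _≤W_ : Word → Word → Set
  _≤W_ = Star _⋖_

  _<W_ : Word → Word → Set
  w <W u = (w ≤W u) × (w ≢ u)

  data Sat : Word → Word → List Word → Set where
    done : ∀ {w} → Sat w w (w ∷ [])
    step : ∀ {w w' u ws} → w ⋖ w' → Sat w' u ws → Sat w u (w ∷ ws)

  MaximalChain : List Word → Set
  MaximalChain c = Sat 0̂ 1̂ c

  _≟L_ : (l l' : Letter) → Dec (l ≡ l')
  a i ≟L a j with i Fin.≟ j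
  ... | yes refl = yes refl
  ... | no ne = no λ { refl → ne refl }
  x k ≟L x l with k Fin.≟ l
  ... | yes refl = yes refl
  ... | no ne = no λ { refl → ne refl }
  a _ ≟L x _ = no λ ()
  x _ ≟L a _ = no λ ()

  -- If w = u ++ l ∷ v and w' = u ++ v (distinct letters) it returns (last u, l).
  firstDiff : Maybe Letter → Word → Word → Maybe (Maybe Letter × Letter)
  firstDiff p [] _ = nothing
  firstDiff p (l ∷ w) [] = just (p , l)
  firstDiff p (l ∷ w) (l' ∷ w') =
    if does (l ≟L l') then firstDiff (just l) w w' else just (p , l)

  _∈ᵇ_ : Fin N → List (Fin N) → Bool
  k ∈ᵇ h = any (λ j → does (k Fin.≟ j)) h

  -- label of one step w ⋖ w', given the list h of those x_k such that an
  -- earlier step of the chain deleted a letter located immediately after x_k.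
  -- Returns the label (as a list with one element for genuine covers) and
  -- the updated h.
  stepLabel : List (Fin N) → Word → Word → List Letter × List (Fin N)
  stepLabel h w w' with length w <ᵇ length w' | firstDiff nothing w' w | firstDiff nothing w w'
  ... | true  | just (_ , l) | _ = (l ∷ []) , h
  ... | true  | nothing      | _ = [] , h                        -- (not a cover)
  ... | false | _ | just (just (x k) , d) =
        if k ∈ᵇ h then (d ∷ []) , h
                  else (x k ∷ []) , (k ∷ h)                   -- (xa)
  ... | false | _ | just (_ , d) = (d ∷ []) , h
  ... | false | _ | nothing = [] , h                           -- (not a cover)

  labelsFrom : List (Fin N) → Word → List Word → List Letter
  labelsFrom h w [] = []
  labelsFrom h w (w' ∷ ws) =
    Data.Product.proj₁ (stepLabel h w w') ++ labelsFrom (Data.Product.proj₂ (stepLabel h w w')) w' ws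

  Λ : List Word → List Letter
  Λ [] = []
  Λ (w ∷ ws) = labelsFrom [] w ws

  Labeling : Set
  Labeling = List Word → List Letter

  IsCLabeling : Labeling → Set
  IsCLabeling L = ∀ c c' → MaximalChain c → MaximalChain c' → ∀ (r : ℕ) →
    take (suc r) c ≡ take (suc r) c' → take r (L c) ≡ take r (L c')

  StrictlyIncreasing : List Letter → Set
  StrictlyIncreasing = Linked _<L_

  -- for the chain P = (w^0 ⋖ ... ⋖ w^r) and the saturated chain q = (w^r ⋖ ... ⋖ w^s):
  -- Λ_{r+1}(c) < ... < Λ_s(c) for every maximal chain c containing w^0 ⋖ ... ⋖ w^s
  IncreasingOn : Labeling → List Word → List Word → Set
  IncreasingOn L P q = ∀ c → MaximalChain c → (∃ λ rest → c ≡ (P ++ drop 1 q) ++ rest) →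
    StrictlyIncreasing (drop r (take s (L c)))
    where
      r = length P ∸ 1
      s = r + (length q ∸ 1)

  IsRStarLabeling : Labeling → Set
  IsRStarLabeling L = IsCLabeling L ×
    (∀ (P : List Word) (wr u : Word) → Sat 0̂ wr P → wr <W u →
       ∃ λ q → (Sat wr u q × IncreasingOn L P q) ×
               (∀ q' → Sat wr u q' → IncreasingOn L P q' → q' ≡ q))

{-# OPTIONS --safe #-}
-- Labels are compared through their ranks a_i ↦ i, x_k ↦ M + k. Λ is a C-labeling because its first
-- r labels are computed step by step from w⁰, …, wʳ.
--
-- Existence: an interval [w, u] is described by an alignment (which a-letters of w disappear, where
-- the x-letters of u appear). For n = 0, 1, …, M + N − 1 perform the pending step whose current label
-- has rank n, if any. Afterwards every remaining pending step has a label of rank > n, so the labels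
-- obtained are strictly increasing, and since ranks are below M + N nothing is pending at the end.
--
-- Uniqueness: compare the first steps of two increasing chains. If their labels differ, the step with
-- the smaller label ℓ must also happen in the other chain, where all labels exceed ℓ; but x_k is only
-- inserted with label x_k, and an a-letter whose deletion label is at most ℓ keeps a deletion label at
-- most the last label used, so it is never deleted. If the labels are equal the steps coincide: a
-- deletion label determines the deleted letter (through its predecessor), and inserting x_k at two
-- positions would place it on both sides of some letter that either survives, contradicting that
-- chains preserve the relative order of letters, or is some a_j that by the previous argument is
-- never deleted after the insertion of x_k.
module Submission where

open import Defs
open import Data.Nat as ℕ using (ℕ; zero; suc; _+_; _<ᵇ_; _≤_; _<_; z≤n)
import Data.Nat.Properties as ℕ
open import Data.Fin as Fin using (Fin; toℕ)
import Data.Fin.Properties as Fin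
open import Data.List using (List; []; _∷_; _++_; _∷ʳ_; length; map; take; drop; takeWhile)
import Data.List.Properties as List
open import Data.List.Relation.Unary.All as All using (All; []; _∷_)
import Data.List.Relation.Unary.All.Properties as All
open import Data.List.Relation.Unary.Any using (Any; here; there; any?)
open import Data.List.Relation.Unary.AllPairs as AllPairs using (AllPairs; []; _∷_)
import Data.List.Relation.Unary.AllPairs.Properties as AllPairsₚ
open import Data.List.Relation.Unary.AllPairs.Properties using (tabulate⁺-<)
open import Data.List.Relation.Unary.Linked using ([]; [-]; _∷_)
open import Data.List.Membership.Propositional using (_∈_; _∉_; find; lose)
open import Data.List.Membership.Propositional.Properties
  using (∈-++⁺ˡ; ∈-++⁺ʳ; ∈-++⁻; ∈-insert; ∈-∃++; ∈-allFin)
import Data.List.Relation.Binary.Sublist.Propositional as Sublist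
open import Data.List.Relation.Binary.Sublist.Propositional.Properties using (takeWhile-⊆)
open import Data.Bool using (true; false; if_then_else_; _∨_)
import Data.Bool.Properties as Bool
open import Data.Maybe using (Maybe; just; nothing)
open import Data.Product using (_×_; _,_; ∃; ∃₂; Σ; proj₁; proj₂)
open import Data.Sum using (_⊎_; inj₁; inj₂; [_,_])
open import Data.Unit using (⊤; tt)
open import Data.Empty using (⊥-elim)
open import Function using (_∘′_; id; flip)
open import Relation.Nullary using (¬_; ¬?; yes; no; does; _×-dec_)
open import Relation.Nullary.Decidable using (dec-true; dec-false)
open import Relation.Binary.Core using (Rel)
open import Relation.Binary.Definitions using (DecidableEquality; tri<; tri≈; tri>)
open import Relation.Binary.PropositionalEquality
  using (_≡_; _≢_; refl; sym; trans; cong; cong₂; subst; module ≡-Reasoning)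
open import Relation.Binary.Construct.Closure.ReflexiveTransitive using (ε; _◅_)

n<ᵇ1+n : ∀ n → (n <ᵇ suc n) ≡ true
n<ᵇ1+n zero    = refl
n<ᵇ1+n (suc n) = n<ᵇ1+n n

1+n<ᵇn : ∀ n → (suc n <ᵇ n) ≡ false
1+n<ᵇn zero    = refl
1+n<ᵇn (suc n) = 1+n<ᵇn n

-- Splitting lists, and lists without repetitions

module _ {ℓ} {A : Set ℓ} where

  lastFrom : Maybe A → List A → Maybe A
  lastFrom p []       = p
  lastFrom p (z ∷ xs) = lastFrom (just z) xs

  lastOf : List A → Maybe A
  lastOf = lastFrom nothing

  lastFrom-++ : ∀ p xs ys → lastFrom p (xs ++ ys) ≡ lastFrom (lastFrom p xs) ys
  lastFrom-++ p []       ys = refl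
  lastFrom-++ p (z ∷ xs) ys = lastFrom-++ (just z) xs ys

  lastFrom-∷ʳ : ∀ p xs z → lastFrom p (xs ∷ʳ z) ≡ just z
  lastFrom-∷ʳ p xs z = lastFrom-++ p xs (z ∷ [])

  lastFrom-skip : ∀ p q xs z y ys → lastFrom p (xs ++ z ∷ y ∷ ys) ≡ lastFrom q (xs ++ y ∷ ys)
  lastFrom-skip p q xs z y ys = begin
    lastFrom p (xs ++ z ∷ y ∷ ys)           ≡⟨ lastFrom-++ p xs (z ∷ y ∷ ys) ⟩
    lastFrom (just y) ys                    ≡⟨ lastFrom-++ q xs (y ∷ ys) ⟨
    lastFrom q (xs ++ y ∷ ys)               ∎
    where open ≡-Reasoning

  lastFrom≡just : ∀ p xs {z} → lastFrom p xs ≡ just z → (xs ≡ [] × p ≡ just z) ⊎ ∃ λ ys → xs ≡ ys ∷ʳ z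
  lastFrom≡just p []       eq = inj₁ (refl , eq)
  lastFrom≡just p (y ∷ xs) eq with lastFrom≡just (just y) xs eq
  ... | inj₁ (refl , refl) = inj₂ ([] , refl)
  ... | inj₂ (ys , refl)   = inj₂ (y ∷ ys , refl)

  lastOf≡just : ∀ (xs : List A) {z} → lastOf xs ≡ just z → ∃ λ ys → xs ≡ ys ∷ʳ z
  lastOf≡just xs eq with lastFrom≡just nothing xs eq
  ... | inj₁ (_ , ())
  ... | inj₂ xs≡ = xs≡

  lastOf-∈ : ∀ (xs : List A) {z} → lastOf xs ≡ just z → z ∈ xs
  lastOf-∈ xs eq with lastOf≡just xs eq
  ... | ys , refl = ∈-insert ys

  ∈-++-∷⁺ : ∀ {v} (xs : List A) y ys → v ∈ xs ++ ys → v ∈ xs ++ y ∷ ys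
  ∈-++-∷⁺ xs y ys = [ ∈-++⁺ˡ , ∈-++⁺ʳ xs ∘′ there ] ∘′ ∈-++⁻ xs

  ∈-++-∷⁻ : ∀ {v} (xs : List A) y ys → v ∈ xs ++ y ∷ ys → v ≢ y → v ∈ xs ++ ys
  ∈-++-∷⁻ []       y ys (here e)   v≢y = ⊥-elim (v≢y e)
  ∈-++-∷⁻ []       y ys (there v∈) v≢y = v∈
  ∈-++-∷⁻ (z ∷ xs) y ys (here e)   v≢y = here e
  ∈-++-∷⁻ (z ∷ xs) y ys (there v∈) v≢y = there (∈-++-∷⁻ xs y ys v∈ v≢y)

  length-++-∷ : ∀ (xs : List A) y ys → length (xs ++ y ∷ ys) ≡ suc (length (xs ++ ys))
  length-++-∷ []       y ys = refl
  length-++-∷ (_ ∷ xs) y ys = cong suc (length-++-∷ xs y ys)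

  drop-take-++ : ∀ (xs ys zs : List A) →
    drop (length xs) (take (length xs + length ys) (xs ++ ys ++ zs)) ≡ ys
  drop-take-++ []       []       zs = refl
  drop-take-++ []       (y ∷ ys) zs = cong (y ∷_) (drop-take-++ [] ys zs)
  drop-take-++ (_ ∷ xs) ys       zs = drop-take-++ xs ys zs

  ++-∷-compare : ∀ (xs : List A) y ys zs z ws → xs ++ y ∷ ys ≡ zs ++ z ∷ ws →
    (xs ≡ zs × y ≡ z × ys ≡ ws) ⊎
    (∃ λ es → zs ≡ xs ++ y ∷ es × ys ≡ es ++ z ∷ ws) ⊎
    (∃ λ es → xs ≡ zs ++ z ∷ es × ws ≡ es ++ y ∷ ys)
  ++-∷-compare []       y ys []       z ws refl = inj₁ (refl , refl , refl)
  ++-∷-compare []       y ys (v ∷ zs) z ws refl = inj₂ (inj₁ (zs , refl , refl))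
  ++-∷-compare (v ∷ xs) y ys []       z ws refl = inj₂ (inj₂ (xs , refl , refl))
  ++-∷-compare (v ∷ xs) y ys (u ∷ zs) z ws eq with List.∷-injective eq
  ... | refl , eq′ with ++-∷-compare xs y ys zs z ws eq′
  ... | inj₁ (refl , refl , refl)      = inj₁ (refl , refl , refl)
  ... | inj₂ (inj₁ (es , refl , refl)) = inj₂ (inj₁ (es , refl , refl))
  ... | inj₂ (inj₂ (es , refl , refl)) = inj₂ (inj₂ (es , refl , refl))

  ++-compare-∷ : ∀ (xs ys zs : List A) z ws → xs ++ ys ≡ zs ++ z ∷ ws →
    (∃ λ es → xs ≡ zs ++ z ∷ es × ws ≡ es ++ ys) ⊎ (∃ λ es → zs ≡ xs ++ es × ys ≡ es ++ z ∷ ws)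
  ++-compare-∷ []       ys zs       z ws refl = inj₂ (zs , refl , refl)
  ++-compare-∷ (v ∷ xs) ys []       z ws refl = inj₁ (xs , refl , refl)
  ++-compare-∷ (v ∷ xs) ys (u ∷ zs) z ws eq with List.∷-injective eq
  ... | refl , eq′ with ++-compare-∷ xs ys zs z ws eq′
  ... | inj₁ (es , refl , refl) = inj₁ (es , refl , refl)
  ... | inj₂ (es , refl , refl) = inj₂ (es , refl , refl)

  ++-compare : ∀ (xs ys zs ws : List A) → xs ++ ys ≡ zs ++ ws →
    (xs ≡ zs × ys ≡ ws) ⊎ (∃₂ λ v es → zs ≡ xs ++ v ∷ es × ys ≡ v ∷ es ++ ws) ⊎
    (∃₂ λ v es → xs ≡ zs ++ v ∷ es × ws ≡ v ∷ es ++ ys)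
  ++-compare []       ys []       ws refl = inj₁ (refl , refl)
  ++-compare []       ys (v ∷ zs) ws refl = inj₂ (inj₁ (v , zs , refl , refl))
  ++-compare (v ∷ xs) ys []       ws refl = inj₂ (inj₂ (v , xs , refl , refl))
  ++-compare (v ∷ xs) ys (u ∷ zs) ws eq with List.∷-injective eq
  ... | refl , eq′ with ++-compare xs ys zs ws eq′
  ... | inj₁ (refl , refl)               = inj₁ (refl , refl)
  ... | inj₂ (inj₁ (y , es , refl , refl)) = inj₂ (inj₁ (y , es , refl , refl))
  ... | inj₂ (inj₂ (y , es , refl , refl)) = inj₂ (inj₂ (y , es , refl , refl))

  ++-∷-cancel : ∀ (xs zs : List A) y ys ws → y ∉ xs → y ∉ zs →
    xs ++ y ∷ ys ≡ zs ++ y ∷ ws → xs ≡ zs × ys ≡ ws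
  ++-∷-cancel xs zs y ys ws y∉xs y∉zs eq with ++-∷-compare xs y ys zs y ws eq
  ... | inj₁ (refl , _ , refl)      = refl , refl
  ... | inj₂ (inj₁ (es , refl , _)) = ⊥-elim (y∉zs (∈-insert xs {es}))
  ... | inj₂ (inj₂ (es , refl , _)) = ⊥-elim (y∉xs (∈-insert zs {es}))

  All-delete : ∀ {p} {P : A → Set p} xs {y ys} → All P (xs ++ y ∷ ys) → All P (xs ++ ys)
  All-delete xs all = All.++⁺ (All.++⁻ˡ xs all) (All.tail (All.++⁻ʳ xs all))

  All-insert : ∀ {p} {P : A → Set p} xs {y ys} → P y → All P (xs ++ ys) → All P (xs ++ y ∷ ys)
  All-insert xs py all = All.++⁺ (All.++⁻ˡ xs all) (py ∷ All.++⁻ʳ xs all)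

  Before : List A → A → A → Set ℓ
  Before ws y z = ∃₂ λ xs ys → ws ≡ xs ++ y ∷ ys × z ∈ ys

  module _ {r} {R : Rel A r} where

    AllPairs-after : ∀ xs {y ys} → AllPairs R (xs ++ y ∷ ys) → All (R y) ys
    AllPairs-after []       (h ∷ _)  = h
    AllPairs-after (z ∷ xs) (_ ∷ ps) = AllPairs-after xs ps

    AllPairs-before : ∀ xs {y ys} → AllPairs R (xs ++ y ∷ ys) → All (λ z → R z y) xs
    AllPairs-before []       _        = []
    AllPairs-before (z ∷ xs) (h ∷ ps) = All.lookup h (∈-insert xs) ∷ AllPairs-before xs ps

    AllPairs-delete : ∀ xs {y ys} → AllPairs R (xs ++ y ∷ ys) → AllPairs R (xs ++ ys)
    AllPairs-delete []       (_ ∷ ps) = ps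
    AllPairs-delete (z ∷ xs) (h ∷ ps) = All-delete xs h ∷ AllPairs-delete xs ps

    AllPairs-insert : ∀ xs {y ys} → (∀ z → R z y) → (∀ z → R y z) →
      AllPairs R (xs ++ ys) → AllPairs R (xs ++ y ∷ ys)
    AllPairs-insert []       {ys = ys} _ Ry ps = All.tabulate (λ {z} _ → Ry z) ∷ ps
    AllPairs-insert (z ∷ xs) Ry yR (h ∷ ps) = All-insert xs (Ry z) h ∷ AllPairs-insert xs Ry yR ps

    AllPairs-lastOf : ∀ xs {z ys} → AllPairs R (xs ++ ys) → lastOf xs ≡ just z → All (R z) ys
    AllPairs-lastOf xs ps eq with lastOf≡just xs eq
    ... | xs₀ , refl = AllPairs-after xs₀ (subst (AllPairs R) (List.++-assoc xs₀ _ _) ps)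

    module _ (R-irrefl : ∀ {y} → ¬ R y y) where

      AllPairs-∉ʳ : ∀ xs {y ys} → AllPairs R (xs ++ y ∷ ys) → y ∉ ys
      AllPairs-∉ʳ xs ps y∈ys = R-irrefl (All.lookup (AllPairs-after xs ps) y∈ys)

      AllPairs-∉ˡ : ∀ xs {y ys} → AllPairs R (xs ++ y ∷ ys) → y ∉ xs
      AllPairs-∉ˡ xs ps y∈xs = R-irrefl (All.lookup (AllPairs-before xs ps) y∈xs)

      AllPairs-∉ : ∀ xs {y ys} → AllPairs R (xs ++ y ∷ ys) → y ∉ xs ++ ys
      AllPairs-∉ xs ps y∈ with ∈-++⁻ xs y∈
      ... | inj₁ y∈xs = AllPairs-∉ˡ xs ps y∈xs
      ... | inj₂ y∈ys = AllPairs-∉ʳ xs ps y∈ys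

      AllPairs-split-unique : ∀ xs zs {y ys ws} → AllPairs R (xs ++ y ∷ ys) →
        xs ++ y ∷ ys ≡ zs ++ y ∷ ws → xs ≡ zs × ys ≡ ws
      AllPairs-split-unique xs zs ps eq = ++-∷-cancel xs zs _ _ _
        (AllPairs-∉ˡ xs ps) (AllPairs-∉ˡ zs (subst (AllPairs R) eq ps)) eq

      AllPairs-successor-unique : ∀ xs zs {y v ys ws u} → AllPairs R (xs ++ y ∷ ys) →
        xs ++ y ∷ ys ≡ zs ++ v ∷ ws → lastOf xs ≡ just u → lastOf zs ≡ just u → y ≡ v
      AllPairs-successor-unique xs zs {y} {v} {ys} {ws} ps eq lx lz
        with lastOf≡just xs lx | lastOf≡just zs lz
      ... | xs₀ , refl | zs₀ , refl =
        List.∷-injectiveˡ (proj₂ (AllPairs-split-unique xs₀ zs₀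
          (subst (AllPairs R) (List.++-assoc xs₀ _ _) ps)
          (trans (sym (List.++-assoc xs₀ _ (y ∷ ys))) (trans eq (List.++-assoc zs₀ _ (v ∷ ws))))))

      Before-asym : ∀ {ws y z} → AllPairs R ws → Before ws y z → ¬ Before ws z y
      Before-asym ps (xs , ys , refl , z∈ys) (zs , vs , eq , y∈vs) with ++-∷-compare xs _ ys zs _ vs eq
      ... | inj₁ (_ , refl , _) = AllPairs-∉ʳ xs ps z∈ys
      ... | inj₂ (inj₁ (es , refl , refl)) = AllPairs-∉ʳ xs ps (∈-++⁺ʳ es (there y∈vs))
      ... | inj₂ (inj₂ (es , refl , refl)) =
        AllPairs-∉ʳ zs (subst (AllPairs R) (List.++-assoc zs _ _) ps) (∈-++⁺ʳ es (there z∈ys))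

  module Predecessor (_≟_ : DecidableEquality A) where

    predecessor : List A → A → Maybe A
    predecessor ws y = lastOf (takeWhile (λ z → ¬? (z ≟ y)) ws)

    predecessor-split : ∀ xs {y ys} → y ∉ xs → predecessor (xs ++ y ∷ ys) y ≡ lastOf xs
    predecessor-split xs {y} {ys} y∉xs = cong lastOf (prefix xs y∉xs)
      where
      prefix : ∀ xs → y ∉ xs → takeWhile (λ z → ¬? (z ≟ y)) (xs ++ y ∷ ys) ≡ xs
      prefix []       _    rewrite dec-true (y ≟ y) refl = refl
      prefix (z ∷ xs) y∉ rewrite dec-false (z ≟ y) (λ z≡y → y∉ (here (sym z≡y))) =
        cong (z ∷_) (prefix xs (y∉ ∘′ there))

    predecessor-∈ : ∀ ws {y v} → predecessor ws y ≡ just v → v ∈ ws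
    predecessor-∈ ws eq = Sublist.lookup (takeWhile-⊆ (λ z → ¬? (z ≟ _)) ws) (lastOf-∈ _ eq)

    module _ {r} {R : Rel A r} (R-irrefl : ∀ {y} → ¬ R y y) where
      open ≡-Reasoning

      AllPairs-predecessor : ∀ xs {y ys} → AllPairs R (xs ++ y ∷ ys) →
        predecessor (xs ++ y ∷ ys) y ≡ lastOf xs
      AllPairs-predecessor xs ps = predecessor-split xs (AllPairs-∉ˡ R-irrefl xs ps)

      AllPairs-predecessor-next : ∀ xs {y z ys} → AllPairs R (xs ++ y ∷ z ∷ ys) →
        predecessor (xs ++ y ∷ z ∷ ys) z ≡ just y
      AllPairs-predecessor-next xs {y} {z} {ys} ps = begin
        predecessor (xs ++ y ∷ z ∷ ys) z
          ≡⟨ cong (flip predecessor z) (List.++-assoc xs (y ∷ []) (z ∷ ys)) ⟨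
        predecessor ((xs ∷ʳ y) ++ z ∷ ys) z
          ≡⟨ AllPairs-predecessor (xs ∷ʳ y) (subst (AllPairs R) (sym (List.++-assoc xs _ _)) ps) ⟩
        lastOf (xs ∷ʳ y)
          ≡⟨ lastFrom-∷ʳ nothing xs y ⟩
        just y ∎

      predecessor-injective : ∀ {ws y z v} → AllPairs R ws → y ∈ ws → z ∈ ws →
        predecessor ws y ≡ just v → predecessor ws z ≡ just v → y ≡ z
      predecessor-injective ps y∈ z∈ py pz
        with A , B , refl ← ∈-∃++ y∈ | C , D , eq ← ∈-∃++ z∈ =
        AllPairs-successor-unique R-irrefl A C ps eq
          (trans (sym (AllPairs-predecessor A ps)) py)
          (trans (sym (AllPairs-predecessor C (subst (AllPairs R) eq ps)))
                 (trans (cong (flip predecessor _) (sym eq)) pz))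

      predecessor-around : ∀ xs {y ys z} → AllPairs R (xs ++ y ∷ ys) → z ∈ xs ++ ys →
        predecessor (xs ++ ys) z ≡ predecessor (xs ++ y ∷ ys) z ⊎ ∃ λ zs → ys ≡ z ∷ zs
      predecessor-around xs {y} {ys} {z} ps z∈ with ∈-++⁻ xs z∈
      ... | inj₁ z∈xs with A , B , refl ← ∈-∃++ z∈xs = inj₁ (begin
        predecessor ((A ++ z ∷ B) ++ ys) z
          ≡⟨ cong (flip predecessor z) (List.++-assoc A (z ∷ B) ys) ⟩
        predecessor (A ++ z ∷ B ++ ys) z
          ≡⟨ predecessor-split A z∉A ⟩
        lastOf A
          ≡⟨ predecessor-split A z∉A ⟨
        predecessor (A ++ z ∷ B ++ y ∷ ys) z
          ≡⟨ cong (flip predecessor z) (List.++-assoc A (z ∷ B) (y ∷ ys)) ⟨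
        predecessor ((A ++ z ∷ B) ++ y ∷ ys) z ∎)
        where
        z∉A : z ∉ A
        z∉A = AllPairs-∉ˡ R-irrefl A (subst (AllPairs R) (List.++-assoc A (z ∷ B) (y ∷ ys)) ps)
      ... | inj₂ z∈ys with ∈-∃++ z∈ys
      ...   | []    , B , refl = inj₂ (B , refl)
      ...   | e ∷ E , B , refl = inj₁ (begin
        predecessor (xs ++ e ∷ E ++ z ∷ B) z
          ≡⟨ cong (flip predecessor z) (List.++-assoc xs (e ∷ E) (z ∷ B)) ⟨
        predecessor ((xs ++ e ∷ E) ++ z ∷ B) z
          ≡⟨ predecessor-split (xs ++ e ∷ E) (z∉ ∘′ ∈-++-∷⁺ xs y (e ∷ E)) ⟩
        lastOf (xs ++ e ∷ E)
          ≡⟨ lastFrom-skip nothing nothing xs y e E ⟨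
        lastOf (xs ++ y ∷ e ∷ E)
          ≡⟨ predecessor-split (xs ++ y ∷ e ∷ E) z∉ ⟨
        predecessor ((xs ++ y ∷ e ∷ E) ++ z ∷ B) z
          ≡⟨ cong (flip predecessor z) (List.++-assoc xs (y ∷ e ∷ E) (z ∷ B)) ⟩
        predecessor (xs ++ y ∷ e ∷ E ++ z ∷ B) z ∎)
        where
        z∉ : z ∉ xs ++ y ∷ e ∷ E
        z∉ = AllPairs-∉ˡ R-irrefl (xs ++ y ∷ e ∷ E)
          (subst (AllPairs R) (sym (List.++-assoc xs (y ∷ e ∷ E) (z ∷ B))) ps)

module RStar (M N : ℕ) where
  open Shuffles M N
  open import Data.List.Membership.DecPropositional _≟L_ using (_∈?_)
  open Predecessor _≟L_

  -- Ranks of letters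

  rank : Letter → ℕ
  rank (a i) = toℕ i
  rank (x k) = M + toℕ k

  rank-a<M : ∀ i → rank (a i) < M
  rank-a<M = Fin.toℕ<n

  M≤rank-x : ∀ k → M ≤ rank (x k)
  M≤rank-x k = ℕ.m≤m+n M (toℕ k)

  rank-a<rank-x : ∀ i k → rank (a i) < rank (x k)
  rank-a<rank-x i k = ℕ.<-≤-trans (rank-a<M i) (M≤rank-x k)

  rank<M+N : ∀ l → rank l < M + N
  rank<M+N (a i) = ℕ.<-≤-trans (rank-a<M i) (ℕ.m≤m+n M N)
  rank<M+N (x k) = ℕ.+-monoʳ-< M (Fin.toℕ<n k)

  rank-injective : ∀ {l l'} → rank l ≡ rank l' → l ≡ l'
  rank-injective {a i} {a j} eq = cong a (Fin.toℕ-injective eq)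
  rank-injective {x k} {x m} eq = cong x (Fin.toℕ-injective (ℕ.+-cancelˡ-≡ M _ _ eq))
  rank-injective {a i} {x k} eq = ⊥-elim (ℕ.<⇒≢ (rank-a<rank-x i k) eq)
  rank-injective {x k} {a i} eq = ⊥-elim (ℕ.<⇒≢ (rank-a<rank-x i k) (sym eq))

  rank<⇒<L : ∀ {l l'} → rank l < rank l' → l <L l'
  rank<⇒<L {a i} {a j} lt = a<a lt
  rank<⇒<L {a i} {x k} lt = a<x
  rank<⇒<L {x k} {x m} lt = x<x (ℕ.+-cancelˡ-< M _ _ lt)
  rank<⇒<L {x k} {a i} lt = ⊥-elim (ℕ.<-asym lt (rank-a<rank-x i k))

  <L⇒rank< : ∀ {l l'} → l <L l' → rank l < rank l'
  <L⇒rank< (a<a lt)          = lt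
  <L⇒rank< {a i} {x k} a<x   = rank-a<rank-x i k
  <L⇒rank< (x<x lt)          = ℕ.+-monoʳ-< M lt

  IncreasingFrom : ℕ → List Letter → Set
  IncreasingFrom n []       = ⊤
  IncreasingFrom n (l ∷ ls) = n ≤ rank l × IncreasingFrom (suc (rank l)) ls

  IncreasingFrom-weaken : ∀ {m n} ls → m ≤ n → IncreasingFrom n ls → IncreasingFrom m ls
  IncreasingFrom-weaken []       m≤n _          = tt
  IncreasingFrom-weaken (l ∷ ls) m≤n (n≤l , inc) = ℕ.≤-trans m≤n n≤l , inc

  IncreasingFrom⇒StrictlyIncreasing : ∀ n ls → IncreasingFrom n ls → StrictlyIncreasing ls
  IncreasingFrom⇒StrictlyIncreasing n []            _               = []
  IncreasingFrom⇒StrictlyIncreasing n (l ∷ [])      _               = [-]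
  IncreasingFrom⇒StrictlyIncreasing n (l ∷ l' ∷ ls) (_ , l<l' , inc) =
    rank<⇒<L l<l' ∷ IncreasingFrom⇒StrictlyIncreasing _ (l' ∷ ls) (l<l' , inc)

  StrictlyIncreasing⇒IncreasingFrom : ∀ ls → StrictlyIncreasing ls → IncreasingFrom 0 ls
  StrictlyIncreasing⇒IncreasingFrom []       _   = tt
  StrictlyIncreasing⇒IncreasingFrom (l ∷ ls) inc = z≤n , above l ls inc
    where
    above : ∀ l ls → StrictlyIncreasing (l ∷ ls) → IncreasingFrom (suc (rank l)) ls
    above l []        _             = tt
    above l (l' ∷ ls) (l<l' ∷ inc) = <L⇒rank< l<l' , above l' ls inc

  -- Labels of covers and chains

  Compat-irrefl : ∀ {l} → ¬ Compat l l
  Compat-irrefl {a i} = Fin.<-irrefl refl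
  Compat-irrefl {x k} = Fin.<-irrefl refl

  shuffle-∉ʳ : ∀ P {l Q} → IsShuffle (P ++ l ∷ Q) → l ∉ Q
  shuffle-∉ʳ = AllPairs-∉ʳ Compat-irrefl

  shuffle-∉ : ∀ P {l Q} → IsShuffle (P ++ l ∷ Q) → l ∉ P ++ Q
  shuffle-∉ = AllPairs-∉ Compat-irrefl

  delLabel : List (Fin N) → Maybe Letter → Letter → Letter
  delLabel h (just (x k)) d = if k ∈ᵇ h then d else x k
  delLabel h (just (a i)) d = d
  delLabel h nothing      d = d

  delHistory : List (Fin N) → Maybe Letter → List (Fin N)
  delHistory h (just (x k)) = if k ∈ᵇ h then h else k ∷ h
  delHistory h (just (a i)) = h
  delHistory h nothing      = h

  delLabel-cases : ∀ h m d → delLabel h m d ≡ d ⊎ ∃ λ k → m ≡ just (x k) × delLabel h m d ≡ x k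
  delLabel-cases h nothing      d = inj₁ refl
  delLabel-cases h (just (a i)) d = inj₁ refl
  delLabel-cases h (just (x k)) d with k ∈ᵇ h
  ... | true  = inj₁ refl
  ... | false = inj₂ (k , refl , refl)

  firstDiff-delete : ∀ p P d Q → d ∉ Q → firstDiff p (P ++ d ∷ Q) (P ++ Q) ≡ just (lastFrom p P , d)
  firstDiff-delete p []      d []      _   = refl
  firstDiff-delete p []      d (l ∷ Q) d∉Q rewrite dec-false (d ≟L l) (d∉Q ∘′ here) = refl
  firstDiff-delete p (l ∷ P) d Q     d∉Q rewrite dec-true (l ≟L l) refl =
    firstDiff-delete (just l) P d Q d∉Q

  stepLabel-delete : ∀ h P i Q → IsShuffle (P ++ a i ∷ Q) →
    stepLabel h (P ++ a i ∷ Q) (P ++ Q) ≡ (delLabel h (lastOf P) (a i) ∷ [] , delHistory h (lastOf P))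
  stepLabel-delete h P i Q sh = by-cases {P ++ a i ∷ Q} {P ++ Q} (lastOf P) shorter
    (firstDiff-delete nothing P (a i) Q (shuffle-∉ʳ P sh))
    where
    shorter : (length (P ++ a i ∷ Q) <ᵇ length (P ++ Q)) ≡ false
    shorter = trans (cong (_<ᵇ length (P ++ Q)) (length-++-∷ P (a i) Q)) (1+n<ᵇn (length (P ++ Q)))
    by-cases : ∀ {w w'} m → (length w <ᵇ length w') ≡ false → firstDiff nothing w w' ≡ just (m , a i) →
      stepLabel h w w' ≡ (delLabel h m (a i) ∷ [] , delHistory h m)
    by-cases nothing      e₁ e₂ rewrite e₁ | e₂ = refl
    by-cases (just (a j)) e₁ e₂ rewrite e₁ | e₂ = refl
    by-cases (just (x k)) e₁ e₂ rewrite e₁ | e₂ with k ∈ᵇ h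
    ... | true  = refl
    ... | false = refl

  stepLabel-insert : ∀ h P k Q → IsShuffle (P ++ x k ∷ Q) →
    stepLabel h (P ++ Q) (P ++ x k ∷ Q) ≡ (x k ∷ [] , h)
  stepLabel-insert h P k Q sh rewrite length-++-∷ P (x k) Q | n<ᵇ1+n (length (P ++ Q))
                                    | firstDiff-delete nothing P (x k) Q (shuffle-∉ʳ P sh) = refl

  label : List (Fin N) → ∀ {w w'} → w ⋖ w' → Letter
  label h (_ , _ , inj₁ (P , _ , i , _ , _)) = delLabel h (lastOf P) (a i)
  label h (_ , _ , inj₂ (_ , _ , k , _ , _)) = x k

  history : List (Fin N) → ∀ {w w'} → w ⋖ w' → List (Fin N)
  history h (_ , _ , inj₁ (P , _ , _ , _ , _)) = delHistory h (lastOf P)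
  history h (_ , _ , inj₂ _)                   = h

  stepLabel-⋖ : ∀ h {w w'} (c : w ⋖ w') → stepLabel h w w' ≡ (label h c ∷ [] , history h c)
  stepLabel-⋖ h (sh , _ , inj₁ (P , Q , i , refl , refl)) = stepLabel-delete h P i Q sh
  stepLabel-⋖ h (_ , sh , inj₂ (P , Q , k , refl , refl)) = stepLabel-insert h P k Q sh

  infixr 5 _∷_
  data Chain : Word → Word → List Word → Set where
    []  : ∀ {w} → Chain w w []
    _∷_ : ∀ {w w' u ws} → w ⋖ w' → Chain w' u ws → Chain w u (w' ∷ ws)

  labels : List (Fin N) → ∀ {w u ws} → Chain w u ws → List Letter
  labels h []       = []
  labels h (c ∷ ch) = label h c ∷ labels (history h c) ch

  labelsFrom≡labels : ∀ h {w u ws} (ch : Chain w u ws) → labelsFrom h w ws ≡ labels h ch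
  labelsFrom≡labels h []       = refl
  labelsFrom≡labels h (c ∷ ch) rewrite stepLabel-⋖ h c =
    cong (label h c ∷_) (labelsFrom≡labels (history h c) ch)

  length-labels : ∀ h {w u ws} (ch : Chain w u ws) → length (labels h ch) ≡ length ws
  length-labels h []       = refl
  length-labels h (c ∷ ch) = cong suc (length-labels (history h c) ch)

  ⋖-history-irrelevant : ∀ h {w w'} (c c' : w ⋖ w') → history h c ≡ history h c'
  ⋖-history-irrelevant h c c' = cong proj₂ (trans (sym (stepLabel-⋖ h c)) (stepLabel-⋖ h c'))

  -- Alignments

  data Alignment : Word → Word → Set where
    []     : Alignment [] []
    keep   : ∀ {l w u} → Alignment w u → Alignment (l ∷ w) (l ∷ u)
    delete : ∀ {i w u} → Alignment w u → Alignment (a i ∷ w) u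
    insert : ∀ {k w u} → Alignment w u → Alignment w (x k ∷ u)

  Alignment-refl : ∀ w → Alignment w w
  Alignment-refl []      = []
  Alignment-refl (l ∷ w) = keep (Alignment-refl w)

  Alignment-deleted : ∀ P {i Q u} → Alignment (P ++ Q) u → Alignment (P ++ a i ∷ Q) u
  Alignment-deleted []      al          = delete al
  Alignment-deleted (l ∷ P) (keep al)   = keep (Alignment-deleted P al)
  Alignment-deleted (l ∷ P) (delete al) = delete (Alignment-deleted P al)
  Alignment-deleted (l ∷ P) (insert al) = insert (Alignment-deleted (l ∷ P) al)

  Alignment-inserted : ∀ P {k Q u} → Alignment (P ++ x k ∷ Q) u → Alignment (P ++ Q) u
  Alignment-inserted []      (keep al)   = insert al
  Alignment-inserted []      (insert al) = insert (Alignment-inserted [] al)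
  Alignment-inserted (l ∷ P) (keep al)   = keep (Alignment-inserted P al)
  Alignment-inserted (l ∷ P) (delete al) = delete (Alignment-inserted P al)
  Alignment-inserted (l ∷ P) (insert al) = insert (Alignment-inserted (l ∷ P) al)

  Alignment-⋖ : ∀ {w w' u} → w ⋖ w' → Alignment w' u → Alignment w u
  Alignment-⋖ (_ , _ , inj₁ (P , _ , _ , refl , refl)) al = Alignment-deleted P al
  Alignment-⋖ (_ , _ , inj₂ (P , _ , _ , refl , refl)) al = Alignment-inserted P al

  ≤W⇒Alignment : ∀ {w u} → w ≤W u → Alignment w u
  ≤W⇒Alignment ε       = Alignment-refl _
  ≤W⇒Alignment (c ◅ s) = Alignment-⋖ c (≤W⇒Alignment s)

  Chain⇒Alignment : ∀ {w u ws} → Chain w u ws → Alignment w u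
  Chain⇒Alignment []       = Alignment-refl _
  Chain⇒Alignment (c ∷ ch) = Alignment-⋖ c (Chain⇒Alignment ch)

  Alignment-a⁻ : ∀ {w u i} → Alignment w u → a i ∈ u → a i ∈ w
  Alignment-a⁻ (keep al)   (here refl) = here refl
  Alignment-a⁻ (keep al)   (there i∈)  = there (Alignment-a⁻ al i∈)
  Alignment-a⁻ (delete al) i∈          = there (Alignment-a⁻ al i∈)
  Alignment-a⁻ (insert al) (there i∈)  = Alignment-a⁻ al i∈

  Alignment-x⁺ : ∀ {w u k} → Alignment w u → x k ∈ w → x k ∈ u
  Alignment-x⁺ (keep al)   (here refl) = here refl
  Alignment-x⁺ (keep al)   (there k∈)  = there (Alignment-x⁺ al k∈)
  Alignment-x⁺ (delete al) (there k∈)  = Alignment-x⁺ al k∈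
  Alignment-x⁺ (insert al) k∈          = there (Alignment-x⁺ al k∈)

  Alignment-dropped : ∀ {w u l} → Alignment w u → l ∈ w → l ∉ u → ∃ λ i → l ≡ a i
  Alignment-dropped {l = a i} al _   _   = i , refl
  Alignment-dropped {l = x k} al k∈w k∉u = ⊥-elim (k∉u (Alignment-x⁺ al k∈w))

  Alignment-delete : ∀ P {l Q u} → Alignment (P ++ l ∷ Q) u → l ∉ u → Alignment (P ++ Q) u
  Alignment-delete []      (keep al)   l∉u = ⊥-elim (l∉u (here refl))
  Alignment-delete []      (delete al) l∉u = al
  Alignment-delete []      (insert al) l∉u = insert (Alignment-delete [] al (l∉u ∘′ there))
  Alignment-delete (_ ∷ P) (keep al)   l∉u = keep (Alignment-delete P al (l∉u ∘′ there))
  Alignment-delete (_ ∷ P) (delete al) l∉u = delete (Alignment-delete P al l∉u)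
  Alignment-delete (l ∷ P) (insert al) l∉u = insert (Alignment-delete (l ∷ P) al (l∉u ∘′ there))

  Alignment-insert : ∀ {w u k} → Alignment w u → x k ∉ w → x k ∈ u →
    ∃₂ λ P Q → w ≡ P ++ Q × Alignment (P ++ x k ∷ Q) u
  Alignment-insert (keep al) k∉w (here refl) = ⊥-elim (k∉w (here refl))
  Alignment-insert (keep {l} al) k∉w (there k∈u) with Alignment-insert al (k∉w ∘′ there) k∈u
  ... | P , Q , refl , al' = l ∷ P , Q , refl , keep al'
  Alignment-insert (delete {i} al) k∉w k∈u with Alignment-insert al (k∉w ∘′ there) k∈u
  ... | P , Q , refl , al' = a i ∷ P , Q , refl , delete al'
  Alignment-insert {w} (insert al) k∉w (here refl) = [] , w , refl , keep al
  Alignment-insert (insert al) k∉w (there k∈u) with Alignment-insert al k∉w k∈u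
  ... | P , Q , eq , al' = P , Q , eq , insert al'

  Alignment-≡ : ∀ {w u} → Alignment w u → IsShuffle w → IsShuffle u →
    (∀ {l} → l ∈ w → l ∈ u) → (∀ {k} → x k ∈ u → x k ∈ w) → w ≡ u
  Alignment-≡ [] _ _ _ _ = refl
  Alignment-≡ (keep {l} al) shw@(_ ∷ shw') shu@(_ ∷ shu') w⊆u xu⊆xw =
    cong (l ∷_) (Alignment-≡ al shw' shu'
      (λ l∈ → ∈-++-∷⁻ [] l _ (w⊆u (there l∈)) λ { refl → shuffle-∉ʳ [] shw l∈ })
      (λ k∈ → ∈-++-∷⁻ [] l _ (xu⊆xw (there k∈)) λ { refl → shuffle-∉ʳ [] shu k∈ }))
  Alignment-≡ (delete al) shw _ w⊆u _ = ⊥-elim (shuffle-∉ʳ [] shw (Alignment-a⁻ al (w⊆u (here refl))))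
  Alignment-≡ (insert al) _ shu _ xu⊆xw =
    ⊥-elim (shuffle-∉ʳ [] shu (Alignment-x⁺ al (xu⊆xw (here refl))))

  -- Compat splits into a condition on a-letters and one on x-letters; only the
  -- latter has to be transported along an alignment.
  AOrdered XOrdered : Letter → Letter → Set
  AOrdered (a i) (a j) = i Fin.< j
  AOrdered _     _     = ⊤
  XOrdered (x k) (x m) = k Fin.< m
  XOrdered _     _     = ⊤

  Compat⇒Ordered : ∀ {l l'} → Compat l l' → AOrdered l l' × XOrdered l l'
  Compat⇒Ordered {a i} {a j} c = c , tt
  Compat⇒Ordered {a i} {x m} c = tt , tt
  Compat⇒Ordered {x k} {a j} c = tt , tt
  Compat⇒Ordered {x k} {x m} c = tt , c

  Ordered⇒Compat : ∀ {l l'} → AOrdered l l' × XOrdered l l' → Compat l l'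
  Ordered⇒Compat {a i} {a j} (c , _) = c
  Ordered⇒Compat {a i} {x m} _       = tt
  Ordered⇒Compat {x k} {a j} _       = tt
  Ordered⇒Compat {x k} {x m} (_ , c) = c

  AOrdered-x : ∀ l k → AOrdered l (x k)
  AOrdered-x (a i) k = tt
  AOrdered-x (x m) k = tt

  x-AOrdered : ∀ k l → AOrdered (x k) l
  x-AOrdered k (a i) = tt
  x-AOrdered k (x m) = tt

  XOrdered-a : ∀ l i → XOrdered l (a i)
  XOrdered-a (a j) i = tt
  XOrdered-a (x k) i = tt

  a-XOrdered : ∀ i l → XOrdered (a i) l
  a-XOrdered i (a j) = tt
  a-XOrdered i (x k) = tt

  All-XOrdered : ∀ {l w u} → Alignment w u → All (XOrdered l) u → All (XOrdered l) w
  All-XOrdered []                  []       = []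
  All-XOrdered (keep al)           (p ∷ ps) = p ∷ All-XOrdered al ps
  All-XOrdered {l} (delete {i} al) ps       = XOrdered-a l i ∷ All-XOrdered al ps
  All-XOrdered (insert al)         (_ ∷ ps) = All-XOrdered al ps

  AllPairs-XOrdered : ∀ {w u} → Alignment w u → AllPairs XOrdered u → AllPairs XOrdered w
  AllPairs-XOrdered []                        ps       = ps
  AllPairs-XOrdered (keep al)                 (p ∷ ps) = All-XOrdered al p ∷ AllPairs-XOrdered al ps
  AllPairs-XOrdered (delete {i} {w} al)       ps       =
    All.tabulate {xs = w} (λ {l} _ → a-XOrdered i l) ∷ AllPairs-XOrdered al ps
  AllPairs-XOrdered (insert al)               (_ ∷ ps) = AllPairs-XOrdered al ps

  shuffle-insert : ∀ P k Q {u} → IsShuffle (P ++ Q) → IsShuffle u → Alignment (P ++ x k ∷ Q) u →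
    IsShuffle (P ++ x k ∷ Q)
  shuffle-insert P k Q sh shu al = AllPairs.zipWith Ordered⇒Compat
    ( AllPairs-insert P (λ l → AOrdered-x l k) (x-AOrdered k) (AllPairs.map (proj₁ ∘′ Compat⇒Ordered) sh)
    , AllPairs-XOrdered al (AllPairs.map (proj₂ ∘′ Compat⇒Ordered) shu))

  Alignment-map-x : ∀ {u L} → IsShuffle u → AllPairs Fin._<_ L → (∀ {k} → x k ∈ u → k ∈ L) →
    Alignment u (map x L)
  Alignment-map-x {[]}      {[]}    _   _         _   = []
  Alignment-map-x {[]}      {l ∷ L} shu (_ ∷ sL)  _   = insert (Alignment-map-x shu sL λ ())
  Alignment-map-x {a i ∷ u} (_ ∷ shu) sL sub = delete (Alignment-map-x shu sL (sub ∘′ there))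
  Alignment-map-x {x k ∷ u} {[]}    _ _ sub with () ← sub (here refl)
  Alignment-map-x {x k ∷ u} {l ∷ L} shu@(k<u ∷ shu') (l<L ∷ sL) sub with k Fin.≟ l
  ... | yes refl = keep (Alignment-map-x shu' sL
          λ m∈u → ∈-++-∷⁻ [] k L (sub (there m∈u)) λ { refl → shuffle-∉ʳ [] shu m∈u })
  ... | no k≢l = insert (Alignment-map-x shu sL
          λ m∈ → ∈-++-∷⁻ [] l L (sub m∈) λ { refl → l∉ m∈ })
    where
    l∉ : x l ∉ x k ∷ u
    l∉ (here refl) = k≢l refl
    l∉ (there l∈u) = Fin.<-asym (All.lookup k<u l∈u)
      (All.lookup l<L (∈-++-∷⁻ [] l L (sub (here refl)) k≢l))

  1̂-shuffle : IsShuffle 1̂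
  1̂-shuffle = AllPairsₚ.map⁺ (tabulate⁺-< id)

  Alignment-1̂ : ∀ {u} → IsShuffle u → Alignment u 1̂
  Alignment-1̂ shu = Alignment-map-x shu (tabulate⁺-< id) (λ {k} _ → ∈-allFin k)

  Chain-shuffle : ∀ {w u ws} → IsShuffle w → Chain w u ws → IsShuffle u
  Chain-shuffle sh []                 = sh
  Chain-shuffle _  ((_ , sh , _) ∷ ch) = Chain-shuffle sh ch

  ⋖-Chain-irrefl : ∀ {w w' ws} → w ⋖ w' → ¬ Chain w' w ws
  ⋖-Chain-irrefl (sh , _ , inj₁ (P , _ , _ , refl , refl)) ch =
    shuffle-∉ P sh (Alignment-a⁻ (Chain⇒Alignment ch) (∈-insert P))
  ⋖-Chain-irrefl (_ , sh , inj₂ (P , _ , _ , refl , refl)) ch =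
    shuffle-∉ P sh (Alignment-x⁺ (Chain⇒Alignment ch) (∈-insert P))

  ∈-⋖-kept : ∀ {w w' u ws l} → w ⋖ w' → Chain w' u ws → l ∈ w → l ∈ u → l ∈ w'
  ∈-⋖-kept (sh , _ , inj₁ (P , Q , i , refl , refl)) ch l∈w l∈u =
    ∈-++-∷⁻ P (a i) Q l∈w λ { refl → shuffle-∉ P sh (Alignment-a⁻ (Chain⇒Alignment ch) l∈u) }
  ∈-⋖-kept (_ , _ , inj₂ (P , Q , k , refl , refl)) ch l∈w l∈u = ∈-++-∷⁺ P (x k) Q l∈w

  Before-⋖ : ∀ {w w' y z} → w ⋖ w' → Before w y z → y ∈ w' → z ∈ w' → Before w' y z
  Before-⋖ {y = y} (sh , _ , inj₁ (P , Q , i , refl , refl)) (A , B , eq , z∈B) y∈ z∈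
    with ++-∷-compare P (a i) Q A y B eq
  ...   | inj₁ (refl , refl , refl) = ⊥-elim (shuffle-∉ P sh y∈)
  ...   | inj₂ (inj₁ (E , refl , refl)) = P ++ E , B , sym (List.++-assoc P E (y ∷ B)) , z∈B
  ...   | inj₂ (inj₂ (E , refl , refl)) = A , E ++ Q , List.++-assoc A (y ∷ E) Q ,
          ∈-++-∷⁻ E (a i) Q z∈B λ { refl → shuffle-∉ (A ++ y ∷ E) sh z∈ }
  Before-⋖ {y = y} (_ , _ , inj₂ (P , Q , k , refl , refl)) (A , B , eq , z∈B) y∈ z∈
    with ++-compare-∷ P Q A y B eq
  ...   | inj₁ (E , refl , refl) =
          A , E ++ x k ∷ Q , List.++-assoc A (y ∷ E) (x k ∷ Q) , ∈-++-∷⁺ E (x k) Q z∈B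
  ...   | inj₂ (E , refl , refl) = P ++ x k ∷ E , B , sym (List.++-assoc P (x k ∷ E) (y ∷ B)) , z∈B

  Before-Chain : ∀ {w u ws y z} → Chain w u ws → Before w y z → y ∈ u → z ∈ u → Before u y z
  Before-Chain []                 bef _   _   = bef
  Before-Chain (c ∷ ch) bef@(A , B , refl , z∈B) y∈u z∈u =
    Before-Chain ch (Before-⋖ c bef (∈-⋖-kept c ch (∈-insert A) y∈u)
                                    (∈-⋖-kept c ch (∈-++⁺ʳ A (there z∈B)) z∈u)) y∈u z∈u

  -- Uniqueness of increasing chains

  x-never-inserted : ∀ h {w u ws} k (ch : Chain w u ws) → x k ∉ w →
    IncreasingFrom (suc (rank (x k))) (labels h ch) → x k ∉ u
  x-never-inserted h k [] k∉w _ = k∉w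
  x-never-inserted h k (c@(_ , _ , inj₁ (P , Q , i , refl , refl)) ∷ ch) k∉w (k<l , inc) =
    x-never-inserted (history h c) k ch (k∉w ∘′ ∈-++-∷⁺ P (a i) Q)
      (IncreasingFrom-weaken _ (ℕ.m≤n⇒m≤1+n k<l) inc)
  x-never-inserted h k ((_ , _ , inj₂ (P , Q , m , refl , refl)) ∷ ch) k∉w (k<m , inc) =
    x-never-inserted h k ch (λ k∈ → k∉w (∈-++-∷⁻ P (x m) Q k∈ λ { refl → ℕ.<-irrefl refl k<m }))
      (IncreasingFrom-weaken _ (ℕ.m≤n⇒m≤1+n k<m) inc)

  _⊆ʰ_ : List (Fin N) → List (Fin N) → Set
  h ⊆ʰ h' = ∀ m → m ∈ᵇ h ≡ true → m ∈ᵇ h' ≡ true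

  ⊆ʰ-refl : ∀ h → h ⊆ʰ h
  ⊆ʰ-refl h _ m∈h = m∈h

  ⊆ʰ-delHistory : ∀ h p → h ⊆ʰ delHistory h p
  ⊆ʰ-delHistory h nothing      m m∈h = m∈h
  ⊆ʰ-delHistory h (just (a i)) m m∈h = m∈h
  ⊆ʰ-delHistory h (just (x k)) m m∈h with k ∈ᵇ h
  ... | true  = m∈h
  ... | false = trans (cong (does (m Fin.≟ k) ∨_) m∈h) (Bool.∨-zeroʳ _)

  -- The invariant of a-survives (l is the last label used): it keeps the label of deleting a_j ≤ l.
  PredBounded : List (Fin N) → ℕ → Maybe Letter → Set
  PredBounded h l nothing      = ⊤
  PredBounded h l (just (a i)) = rank (a i) ≤ l
  PredBounded h l (just (x m)) = m ∈ᵇ h ≡ true ⊎ rank (x m) ≤ l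

  PredBounded-mono : ∀ {h h' l l'} p → h ⊆ʰ h' → l ≤ l' → PredBounded h l p → PredBounded h' l' p
  PredBounded-mono nothing      _   _   _        = tt
  PredBounded-mono (just (a i)) _   l≤l' pb       = ℕ.≤-trans pb l≤l'
  PredBounded-mono (just (x m)) h⊆h' _   (inj₁ e) = inj₁ (h⊆h' m e)
  PredBounded-mono (just (x m)) _   l≤l' (inj₂ pb) = inj₂ (ℕ.≤-trans pb l≤l')

  delLabel-bounded : ∀ h l m d → PredBounded h l m → rank d ≤ l → rank (delLabel h m d) ≤ l
  delLabel-bounded h l nothing      d _  d≤l = d≤l
  delLabel-bounded h l (just (a i)) d _  d≤l = d≤l
  delLabel-bounded h l (just (x k)) d pb d≤l with k ∈ᵇ h
  ... | true = d≤l
  ... | false with pb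
  ...   | inj₂ k≤l = k≤l

  PredBounded-pred-deleted : ∀ h l m i → rank (a i) ≤ l → l < rank (delLabel h m (a i)) →
    PredBounded (delHistory h m) (rank (delLabel h m (a i))) m
  PredBounded-pred-deleted h l nothing      i i≤l l< = ⊥-elim (ℕ.≤⇒≯ i≤l l<)
  PredBounded-pred-deleted h l (just (a j)) i i≤l l< = ⊥-elim (ℕ.≤⇒≯ i≤l l<)
  PredBounded-pred-deleted h l (just (x k)) i i≤l with k ∈ᵇ h
  ... | true  = λ l< → ⊥-elim (ℕ.≤⇒≯ i≤l l<)
  ... | false = λ _ → inj₂ ℕ.≤-refl

  PredBounded-deleted : ∀ h l P i E → l < rank (delLabel h (lastOf P) (a i)) →
    PredBounded h l (lastOf (P ++ a i ∷ E)) →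
    PredBounded (delHistory h (lastOf P)) (rank (delLabel h (lastOf P) (a i))) (lastOf (P ++ E))
  PredBounded-deleted h l P i [] l< pb =
    subst (PredBounded _ _ ∘′ lastOf) (sym (List.++-identityʳ P))
      (PredBounded-pred-deleted h l (lastOf P) i
        (subst (PredBounded h l) (lastFrom-∷ʳ nothing P (a i)) pb) l<)
  PredBounded-deleted h l P i (e ∷ E) l< pb =
    PredBounded-mono _ (⊆ʰ-delHistory h (lastOf P)) (ℕ.<⇒≤ l<)
      (subst (PredBounded h l) (lastFrom-skip nothing nothing P (a i) e E) pb)

  PredBounded-inserted : ∀ h l l' P k E → l ≤ l' → rank (x k) ≤ l' → PredBounded h l (lastOf (P ++ E)) →
    PredBounded h l' (lastOf (P ++ x k ∷ E))
  PredBounded-inserted h l l' P k []      _    k≤l' _  =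
    subst (PredBounded h l') (sym (lastFrom-∷ʳ nothing P (x k))) (inj₂ k≤l')
  PredBounded-inserted h l l' P k (e ∷ E) l≤l' _   pb =
    subst (PredBounded h l') (sym (lastFrom-skip nothing nothing P (x k) e E))
      (PredBounded-mono _ (⊆ʰ-refl h) l≤l' pb)

  a-survives : ∀ h l j A B {w u ws} (ch : Chain w u ws) → w ≡ A ++ a j ∷ B → PredBounded h l (lastOf A) →
    rank (a j) ≤ l → IncreasingFrom (suc l) (labels h ch) → a j ∈ u
  a-survives h l j A B [] refl _ _ _ = ∈-insert A
  a-survives h l j A B (c@(_ , _ , inj₁ (P , Q , i , refl , refl)) ∷ ch) eq pb j≤l (l< , inc)
    with ++-∷-compare P (a i) Q A (a j) B eq
  ... | inj₁ (refl , refl , refl) = ⊥-elim (ℕ.≤⇒≯ (delLabel-bounded h l (lastOf P) (a i) pb j≤l) l<)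
  ... | inj₂ (inj₁ (E , refl , refl)) =
    a-survives _ _ j (P ++ E) B ch (sym (List.++-assoc P E (a j ∷ B)))
      (PredBounded-deleted h l P i E l< pb) (ℕ.≤-trans j≤l (ℕ.<⇒≤ l<)) inc
  ... | inj₂ (inj₂ (E , refl , refl)) =
    a-survives _ _ j A (E ++ Q) ch (List.++-assoc A (a j ∷ E) Q)
      (PredBounded-mono _ (⊆ʰ-delHistory h (lastOf P)) (ℕ.<⇒≤ l<) pb) (ℕ.≤-trans j≤l (ℕ.<⇒≤ l<)) inc
  a-survives h l j A B ((_ , _ , inj₂ (P , Q , k , refl , refl)) ∷ ch) eq pb j≤l (l< , inc)
    with ++-compare-∷ P Q A (a j) B eq
  ... | inj₁ (E , refl , refl) =
    a-survives h _ j A (E ++ x k ∷ Q) ch (List.++-assoc A (a j ∷ E) (x k ∷ Q))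
      (PredBounded-mono _ (⊆ʰ-refl h) (ℕ.<⇒≤ l<) pb) (ℕ.≤-trans j≤l (ℕ.<⇒≤ l<)) inc
  ... | inj₂ (E , refl , refl) =
    a-survives h _ j (P ++ x k ∷ E) B ch (sym (List.++-assoc P (x k ∷ E) (a j ∷ B)))
      (PredBounded-inserted h l _ P k E (ℕ.<⇒≤ l<) ℕ.≤-refl pb) (ℕ.≤-trans j≤l (ℕ.<⇒≤ l<)) inc

  PredBounded-self : ∀ h P i Q → IsShuffle (P ++ a i ∷ Q) →
    PredBounded h (rank (delLabel h (lastOf P) (a i))) (lastOf P)
  PredBounded-self h P i Q sh with lastOf P in eq
  ... | nothing    = tt
  ... | just (a j) = ℕ.<⇒≤ (All.head (AllPairs-lastOf P sh eq))
  ... | just (x k) with k ∈ᵇ h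
  ...   | true  = inj₁ refl
  ...   | false = inj₂ ℕ.≤-refl

  rank≤delLabel : ∀ h m i → rank (a i) ≤ rank (delLabel h m (a i))
  rank≤delLabel h nothing      i = ℕ.≤-refl
  rank≤delLabel h (just (a j)) i = ℕ.≤-refl
  rank≤delLabel h (just (x k)) i with k ∈ᵇ h
  ... | true  = ℕ.≤-refl
  ... | false = ℕ.<⇒≤ (rank-a<rank-x i k)

  no-increasing-chain-above : ∀ h {w w₁ u ws₁ ws} (c : w ⋖ w₁) → Chain w₁ u ws₁ → (ch : Chain w u ws) →
    ¬ IncreasingFrom (suc (rank (label h c))) (labels h ch)
  no-increasing-chain-above h (sh , _ , inj₁ (P , Q , i , refl , refl)) ch₁ ch inc =
    shuffle-∉ P sh (Alignment-a⁻ (Chain⇒Alignment ch₁)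
      (a-survives h _ i P Q ch refl (PredBounded-self h P i Q sh) (rank≤delLabel h (lastOf P) i) inc))
  no-increasing-chain-above h (_ , sh , inj₂ (P , Q , k , refl , refl)) ch₁ ch inc =
    x-never-inserted h k ch (shuffle-∉ P sh) inc (Alignment-x⁺ (Chain⇒Alignment ch₁) (∈-insert P))

  delLabel≡x⇒pred : ∀ h m i k → delLabel h m (a i) ≡ x k → m ≡ just (x k)
  delLabel≡x⇒pred h m i k eq with delLabel-cases h m (a i)
  ... | inj₁ e with () ← trans (sym e) eq
  ... | inj₂ (k' , m≡ , e) with refl ← trans (sym e) eq = m≡

  delLabel≢absent-x : ∀ h P₁ i Q₁ P₂ k Q₂ → IsShuffle (P₂ ++ x k ∷ Q₂) → P₁ ++ a i ∷ Q₁ ≡ P₂ ++ Q₂ →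
    delLabel h (lastOf P₁) (a i) ≢ x k
  delLabel≢absent-x h P₁ i Q₁ P₂ k Q₂ sh e eq =
    shuffle-∉ P₂ sh (subst (x k ∈_) e (∈-++⁺ˡ (lastOf-∈ P₁ (delLabel≡x⇒pred h (lastOf P₁) i k eq))))

  delLabel-injective : ∀ h P₁ i₁ Q₁ P₂ i₂ Q₂ → IsShuffle (P₁ ++ a i₁ ∷ Q₁) →
    P₁ ++ a i₁ ∷ Q₁ ≡ P₂ ++ a i₂ ∷ Q₂ →
    delLabel h (lastOf P₁) (a i₁) ≡ delLabel h (lastOf P₂) (a i₂) → a i₁ ≡ a i₂
  delLabel-injective h P₁ i₁ Q₁ P₂ i₂ Q₂ sh e eq
    with delLabel-cases h (lastOf P₁) (a i₁) | delLabel-cases h (lastOf P₂) (a i₂)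
  ... | inj₁ e₁ | inj₁ e₂ = trans (sym e₁) (trans eq e₂)
  ... | inj₁ e₁ | inj₂ (_ , _ , e₂) with () ← trans (sym e₁) (trans eq e₂)
  ... | inj₂ (_ , _ , e₁) | inj₁ e₂ with () ← trans (sym e₂) (trans (sym eq) e₁)
  ... | inj₂ (_ , m₁ , e₁) | inj₂ (_ , m₂ , e₂) with refl ← trans (sym e₁) (trans eq e₂) =
    AllPairs-successor-unique Compat-irrefl P₁ P₂ sh e m₁ m₂

  PredBounded-before-x : ∀ h P l B k → IsShuffle (P ++ l ∷ B) → x k ∈ l ∷ B →
    PredBounded h (rank (x k)) (lastOf P)
  PredBounded-before-x h P l B k sh k∈ with lastOf P in eq
  ... | nothing    = tt
  ... | just (a i) = ℕ.<⇒≤ (rank-a<rank-x i k)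
  ... | just (x m) = inj₂ (ℕ.+-monoʳ-≤ M (ℕ.<⇒≤ (All.lookup (AllPairs-lastOf P sh eq) k∈)))

  x-inserted-on-both-sides : ∀ h k P l R Q {u ws₁ ws₂} →
    IsShuffle (P ++ x k ∷ l ∷ R ++ Q) → IsShuffle ((P ++ l ∷ R) ++ x k ∷ Q) →
    Chain (P ++ x k ∷ l ∷ R ++ Q) u ws₁ → (ch₂ : Chain ((P ++ l ∷ R) ++ x k ∷ Q) u ws₂) →
    ¬ IncreasingFrom (suc (rank (x k))) (labels h ch₂)
  x-inserted-on-both-sides h k P l R Q {u} sh₁ sh₂ ch₁ ch₂ inc with l ∈? u
  ... | yes l∈u = Before-asym Compat-irrefl (Chain-shuffle sh₁ ch₁)
    (Before-Chain ch₁ (P , l ∷ R ++ Q , refl , here refl) k∈u l∈u)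
    (Before-Chain ch₂ (P , R ++ x k ∷ Q , List.++-assoc P (l ∷ R) (x k ∷ Q) , ∈-++⁺ʳ R (here refl))
      l∈u k∈u)
    where
    k∈u : x k ∈ u
    k∈u = Alignment-x⁺ (Chain⇒Alignment ch₁) (∈-insert P)
  ... | no l∉u with Alignment-dropped (Chain⇒Alignment ch₁) (∈-++⁺ʳ P (there (here refl))) l∉u
  ...   | j , refl = l∉u (a-survives h (rank (x k)) j P (R ++ x k ∷ Q) ch₂
            (List.++-assoc P (a j ∷ R) (x k ∷ Q))
            (PredBounded-before-x h P (a j) (R ++ x k ∷ Q) k sh₂′ (there (∈-++⁺ʳ R (here refl))))
            (ℕ.<⇒≤ (rank-a<rank-x j k)) inc)
    where
    sh₂′ : IsShuffle (P ++ a j ∷ R ++ x k ∷ Q)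
    sh₂′ = subst IsShuffle (List.++-assoc P (a j ∷ R) (x k ∷ Q)) sh₂

  same-label⇒same-step : ∀ h {w w₁ w₂ u ws₁ ws₂} → IsShuffle w → (c₁ : w ⋖ w₁) (c₂ : w ⋖ w₂) →
    label h c₁ ≡ label h c₂ → (ch₁ : Chain w₁ u ws₁) (ch₂ : Chain w₂ u ws₂) →
    IncreasingFrom (suc (rank (label h c₁))) (labels (history h c₁) ch₁) →
    IncreasingFrom (suc (rank (label h c₂))) (labels (history h c₂) ch₂) → w₁ ≡ w₂
  same-label⇒same-step h sh
    (_ , _ , inj₁ (P₁ , Q₁ , i₁ , refl , refl)) (_ , _ , inj₁ (P₂ , Q₂ , i₂ , e , refl)) l≡ _ _ _ _
    with refl ← delLabel-injective h P₁ i₁ Q₁ P₂ i₂ Q₂ sh e l≡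
    with refl , refl ← AllPairs-split-unique Compat-irrefl P₁ P₂ sh e = refl
  same-label⇒same-step h sh
    (_ , _ , inj₁ (P₁ , Q₁ , i , refl , refl)) (_ , sh₂ , inj₂ (P₂ , Q₂ , k , e , refl)) l≡ _ _ _ _ =
    ⊥-elim (delLabel≢absent-x h P₁ i Q₁ P₂ k Q₂ sh₂ e l≡)
  same-label⇒same-step h sh
    (_ , sh₁ , inj₂ (P₁ , Q₁ , k , refl , refl)) (_ , _ , inj₁ (P₂ , Q₂ , i , e , refl)) l≡ _ _ _ _ =
    ⊥-elim (delLabel≢absent-x h P₂ i Q₂ P₁ k Q₁ sh₁ (sym e) (sym l≡))
  same-label⇒same-step h sh
    (_ , sh₁ , inj₂ (P₁ , Q₁ , k , refl , refl)) (_ , sh₂ , inj₂ (P₂ , Q₂ , _ , e , refl))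
    refl ch₁ ch₂ inc₁ inc₂
    with ++-compare P₁ Q₁ P₂ Q₂ e
  ... | inj₁ (refl , refl) = refl
  ... | inj₂ (inj₁ (l , R , refl , refl)) =
    ⊥-elim (x-inserted-on-both-sides h k P₁ l R Q₂ sh₁ sh₂ ch₁ ch₂ inc₂)
  ... | inj₂ (inj₂ (l , R , refl , refl)) =
    ⊥-elim (x-inserted-on-both-sides h k P₂ l R Q₁ sh₂ sh₁ ch₂ ch₁ inc₁)

  first-step-unique : ∀ h {w w₁ w₂ u ws₁ ws₂} → IsShuffle w → (c₁ : w ⋖ w₁) (c₂ : w ⋖ w₂)
    (ch₁ : Chain w₁ u ws₁) (ch₂ : Chain w₂ u ws₂) →
    IncreasingFrom 0 (labels h (c₁ ∷ ch₁)) → IncreasingFrom 0 (labels h (c₂ ∷ ch₂)) → w₁ ≡ w₂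
  first-step-unique h sh c₁ c₂ ch₁ ch₂ (_ , inc₁) (_ , inc₂)
    with ℕ.<-cmp (rank (label h c₁)) (rank (label h c₂))
  ... | tri< l₁<l₂ _ _ = ⊥-elim (no-increasing-chain-above h c₁ ch₁ (c₂ ∷ ch₂) (l₁<l₂ , inc₂))
  ... | tri> _ _ l₂<l₁ = ⊥-elim (no-increasing-chain-above h c₂ ch₂ (c₁ ∷ ch₁) (l₂<l₁ , inc₁))
  ... | tri≈ _ l₁≡l₂ _ = same-label⇒same-step h sh c₁ c₂ (rank-injective l₁≡l₂) ch₁ ch₂ inc₁ inc₂

  increasing-chain-unique : ∀ h {w u ws ws'} → IsShuffle w → (ch : Chain w u ws) (ch' : Chain w u ws') →
    IncreasingFrom 0 (labels h ch) → IncreasingFrom 0 (labels h ch') → ws ≡ ws'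
  increasing-chain-unique h sh [] [] _ _ = refl
  increasing-chain-unique h sh [] (c ∷ ch) _ _ = ⊥-elim (⋖-Chain-irrefl c ch)
  increasing-chain-unique h sh (c ∷ ch) [] _ _ = ⊥-elim (⋖-Chain-irrefl c ch)
  increasing-chain-unique h sh (c₁ ∷ ch₁) (c₂ ∷ ch₂) inc₁ inc₂
    with refl ← first-step-unique h sh c₁ c₂ ch₁ ch₂ inc₁ inc₂ =
    cong (_ ∷_) (increasing-chain-unique (history h c₁) (proj₁ (proj₂ c₁)) ch₁ ch₂
      (IncreasingFrom-weaken _ z≤n (proj₂ inc₁))
      (subst (λ h' → IncreasingFrom 0 (labels h' ch₂)) (⋖-history-irrelevant h c₂ c₁)
        (IncreasingFrom-weaken _ z≤n (proj₂ inc₂))))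

  strictly-increasing-chain-unique : ∀ h {w u ws ws'} → IsShuffle w → Chain w u ws → Chain w u ws' →
    StrictlyIncreasing (labelsFrom h w ws) → StrictlyIncreasing (labelsFrom h w ws') → ws ≡ ws'
  strictly-increasing-chain-unique h sh ch ch' inc inc' = increasing-chain-unique h sh ch ch'
    (StrictlyIncreasing⇒IncreasingFrom _ (subst StrictlyIncreasing (labelsFrom≡labels h ch) inc))
    (StrictlyIncreasing⇒IncreasingFrom _ (subst StrictlyIncreasing (labelsFrom≡labels h ch') inc'))

  -- Existence of increasing chains

  delLabel≢a : ∀ h p i j → a j ≢ a i → delLabel h p (a i) ≢ a j
  delLabel≢a h p i j j≢i eq with delLabel-cases h p (a i)
  ... | inj₁ e = j≢i (trans (sym eq) e)
  ... | inj₂ (_ , _ , e) with () ← trans (sym e) eq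

  delLabel-fresh : ∀ h k p d → p ≢ just (x k) → delLabel (k ∷ h) p d ≡ delLabel h p d
  delLabel-fresh h k nothing       d _   = refl
  delLabel-fresh h k (just (a i))  d _   = refl
  delLabel-fresh h k (just (x k')) d p≢ rewrite dec-false (k' Fin.≟ k) (λ { refl → p≢ refl }) = refl

  -- a letter triggers rule (xa) at most once
  delLabel-delHistory : ∀ h p d → delLabel (delHistory h p) p d ≡ d
  delLabel-delHistory h nothing      d = refl
  delLabel-delHistory h (just (a i)) d = refl
  delLabel-delHistory h (just (x k)) d with k ∈ᵇ h in e
  ... | true  rewrite e = refl
  ... | false rewrite dec-true (k Fin.≟ k) refl = refl

  above-label : ∀ {n l L} → rank L ≡ n → n ≤ rank l → l ≢ L → n < rank l
  above-label refl n≤l l≢L = ℕ.≤∧≢⇒< n≤l (λ eq → l≢L (rank-injective (sym eq)))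

  delLabel-raised : ∀ {n} h pᵢ p i j → a j ≢ a i → (∀ {v} → p ≡ just v → pᵢ ≢ just v) →
    rank (delLabel h pᵢ (a i)) ≡ n → n ≤ rank (delLabel h p (a j)) →
    n < rank (delLabel (delHistory h pᵢ) p (a j))
  delLabel-raised h nothing      p i j j≢i _ L≡n n≤ =
    above-label L≡n n≤ (delLabel≢a h p j i (j≢i ∘′ sym))
  delLabel-raised h (just (a m)) p i j j≢i _ L≡n n≤ =
    above-label L≡n n≤ (delLabel≢a h p j i (j≢i ∘′ sym))
  delLabel-raised h (just (x k)) p i j j≢i p≢pᵢ L≡n n≤ with k ∈ᵇ h
  ... | true  = above-label L≡n n≤ (delLabel≢a h p j i (j≢i ∘′ sym))
  ... | false rewrite delLabel-fresh h k p (a j) (λ p≡ → p≢pᵢ p≡ refl) =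
    above-label L≡n n≤ (λ eq → p≢pᵢ (delLabel≡x⇒pred h p j k eq) refl)

  record PendingFrom (n : ℕ) (h : List (Fin N)) (w u : Word) : Set where
    field
      deletions  : ∀ {l} → l ∈ w → l ∉ u → n ≤ rank (delLabel h (predecessor w l) l)
      insertions : ∀ {k} → x k ∉ w → x k ∈ u → n ≤ rank (x k)

  PendingFrom-delete : ∀ {u} h n P i Q → IsShuffle (P ++ a i ∷ Q) → Alignment (P ++ a i ∷ Q) u →
    PendingFrom n h (P ++ a i ∷ Q) u → rank (delLabel h (lastOf P) (a i)) ≡ n →
    PendingFrom (suc n) (delHistory h (lastOf P)) (P ++ Q) u
  PendingFrom-delete {u} h n P i Q sh al pending L≡n =
    record { deletions = deletions ; insertions = insertions }
    where
    open PendingFrom pending renaming (deletions to deletions₀; insertions to insertions₀)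
    deletions : ∀ {l} → l ∈ P ++ Q → l ∉ u →
      suc n ≤ rank (delLabel (delHistory h (lastOf P)) (predecessor (P ++ Q) l) l)
    deletions l∈ l∉u with Alignment-dropped al (∈-++-∷⁺ P (a i) Q l∈) l∉u
    ... | j , refl with predecessor-around Compat-irrefl P sh l∈
    ...   | inj₁ same-pred rewrite same-pred =
      delLabel-raised h (lastOf P) _ i j j≢i distinct-preds L≡n (deletions₀ (∈-++-∷⁺ P (a i) Q l∈) l∉u)
      where
      j≢i : a j ≢ a i
      j≢i refl = shuffle-∉ P sh l∈
      distinct-preds : ∀ {v} → predecessor (P ++ a i ∷ Q) (a j) ≡ just v → lastOf P ≢ just v
      distinct-preds pj pi = j≢i (predecessor-injective Compat-irrefl sh
        (∈-++-∷⁺ P (a i) Q l∈) (∈-insert P) pj (trans (AllPairs-predecessor Compat-irrefl P sh) pi))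
    ...   | inj₂ (B , refl)
      with n≤j ← deletions₀ (∈-++-∷⁺ P (a i) Q l∈) l∉u
      rewrite AllPairs-predecessor Compat-irrefl P (AllPairs-delete P sh)
            | delLabel-delHistory h (lastOf P) (a j)
            | AllPairs-predecessor-next Compat-irrefl P sh =
      above-label L≡n n≤j (delLabel≢a h (lastOf P) i j (λ { refl → shuffle-∉ P sh l∈ }) ∘′ sym)
    insertions : ∀ {k} → x k ∉ P ++ Q → x k ∈ u → suc n ≤ rank (x k)
    insertions {k} k∉ k∈u = above-label L≡n (insertions₀ (λ k∈ → k∉ (∈-++-∷⁻ P (a i) Q k∈ λ ())) k∈u)
      λ eq → k∉ (∈-++⁺ˡ (lastOf-∈ P (delLabel≡x⇒pred h (lastOf P) i k (sym eq))))

  PendingFrom-insert : ∀ {u} h n P k Q → IsShuffle (P ++ x k ∷ Q) → Alignment (P ++ Q) u → x k ∈ u →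
    PendingFrom n h (P ++ Q) u → rank (x k) ≡ n → PendingFrom (suc n) h (P ++ x k ∷ Q) u
  PendingFrom-insert {u} h n P k Q sh al k∈u pending k≡n =
    record { deletions = deletions ; insertions = insertions }
    where
    open PendingFrom pending renaming (deletions to deletions₀; insertions to insertions₀)
    k∉ : x k ∉ P ++ Q
    k∉ = shuffle-∉ P sh
    deletions : ∀ {l} → l ∈ P ++ x k ∷ Q → l ∉ u →
      suc n ≤ rank (delLabel h (predecessor (P ++ x k ∷ Q) l) l)
    deletions l∈ l∉u with ∈-++-∷⁻ P (x k) Q l∈ (λ { refl → l∉u k∈u })
    ... | l∈PQ with Alignment-dropped al l∈PQ l∉u
    ...   | j , refl with predecessor-around Compat-irrefl P sh l∈PQ
    ...     | inj₁ same-pred rewrite sym same-pred = above-label {L = x k} k≡n (deletions₀ l∈PQ l∉u)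
      λ eq → k∉ (predecessor-∈ (P ++ Q) (delLabel≡x⇒pred h _ j k eq))
    ...     | inj₂ (B , refl) with n≤ ← deletions₀ l∈PQ l∉u
      rewrite AllPairs-predecessor Compat-irrefl P (AllPairs-delete P sh) = ⊥-elim (no-label-above-k n≤)
      where
      -- a label of rank ≥ rank (x k) would have to be an x-letter preceding x k
      no-label-above-k : ¬ n ≤ rank (delLabel h (lastOf P) (a j))
      no-label-above-k with delLabel-cases h (lastOf P) (a j)
      ... | inj₁ e rewrite e | sym k≡n = ℕ.<⇒≱ (rank-a<rank-x j k)
      ... | inj₂ (m , m-pred , e) rewrite e | sym k≡n =
        ℕ.<⇒≱ (ℕ.+-monoʳ-< M (All.head (AllPairs-lastOf P sh m-pred)))
    insertions : ∀ {m} → x m ∉ P ++ x k ∷ Q → x m ∈ u → suc n ≤ rank (x m)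
    insertions {m} m∉ m∈u =
      above-label {l = x m} {L = x k} k≡n (insertions₀ (m∉ ∘′ ∈-++-∷⁺ P (x k) Q) m∈u)
      λ { refl → m∉ (∈-insert P) }

  DeletableAt : ℕ → List (Fin N) → Word → Word → Letter → Set
  DeletableAt n h w u l = l ∉ u × rank (delLabel h (predecessor w l) l) ≡ n

  InsertableAt : ℕ → Word → Word → Fin N → Set
  InsertableAt n w u k = x k ∉ w × x k ∈ u × rank (x k) ≡ n

  PendingFrom-skip : ∀ {n h w u} → PendingFrom n h w u → ¬ Any (DeletableAt n h w u) w →
    ¬ ∃ (InsertableAt n w u) → PendingFrom (suc n) h w u
  PendingFrom-skip pending no-del no-ins = record
    { deletions  = λ l∈ l∉u → ℕ.≤∧≢⇒< (deletions l∈ l∉u) (λ eq → no-del (lose l∈ (l∉u , sym eq)))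
    ; insertions = λ k∉ k∈u → ℕ.≤∧≢⇒< (insertions k∉ k∈u) (λ eq → no-ins (_ , k∉ , k∈u , sym eq))
    }
    where open PendingFrom pending

  PendingFrom-M+N⇒≡ : ∀ {h w u} → PendingFrom (M + N) h w u → Alignment w u →
    IsShuffle w → IsShuffle u → w ≡ u
  PendingFrom-M+N⇒≡ {h} {w} {u} pending al shw shu = Alignment-≡ al shw shu kept inserted
    where
    open PendingFrom pending
    kept : ∀ {l} → l ∈ w → l ∈ u
    kept {l} l∈ with l ∈? u
    ... | yes l∈u = l∈u
    ... | no  l∉u = ⊥-elim (ℕ.<⇒≱ (rank<M+N (delLabel h (predecessor w l) l)) (deletions l∈ l∉u))
    inserted : ∀ {k} → x k ∈ u → x k ∈ w
    inserted {k} k∈ with x k ∈? w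
    ... | yes k∈w = k∈w
    ... | no  k∉w = ⊥-elim (ℕ.<⇒≱ (rank<M+N (x k)) (insertions k∉w k∈))

  IncreasingFrom-∷ : ∀ {n} l {ls} → rank l ≡ n → IncreasingFrom (suc n) ls → IncreasingFrom n (l ∷ ls)
  IncreasingFrom-∷ l refl inc = ℕ.≤-refl , inc

  IncreasingChain : ℕ → List (Fin N) → Word → Word → Set
  IncreasingChain n h w u = ∃ λ ws → Σ (Chain w u ws) λ ch → IncreasingFrom n (labels h ch)

  IncreasingChain-weaken : ∀ {n h w u} → IncreasingChain (suc n) h w u → IncreasingChain n h w u
  IncreasingChain-weaken {n} (ws , ch , inc) = ws , ch , IncreasingFrom-weaken _ (ℕ.n≤1+n n) inc

  IncreasingChain-delete : ∀ {n u} h P i Q → IsShuffle (P ++ a i ∷ Q) →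
    rank (delLabel h (lastOf P) (a i)) ≡ n →
    IncreasingChain (suc n) (delHistory h (lastOf P)) (P ++ Q) u → IncreasingChain n h (P ++ a i ∷ Q) u
  IncreasingChain-delete h P i Q sh L≡n (ws , ch , inc) =
    (P ++ Q) ∷ ws , (sh , AllPairs-delete P sh , inj₁ (P , Q , i , refl , refl)) ∷ ch ,
    IncreasingFrom-∷ (delLabel h (lastOf P) (a i)) L≡n inc

  IncreasingChain-insert : ∀ {n u} h P k Q → IsShuffle (P ++ Q) → IsShuffle (P ++ x k ∷ Q) →
    rank (x k) ≡ n →
    IncreasingChain (suc n) h (P ++ x k ∷ Q) u → IncreasingChain n h (P ++ Q) u
  IncreasingChain-insert h P k Q sh sh' k≡n (ws , ch , inc) =
    (P ++ x k ∷ Q) ∷ ws , (sh , sh' , inj₂ (P , Q , k , refl , refl)) ∷ ch ,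
    IncreasingFrom-∷ (x k) k≡n inc

  -- At threshold n perform the pending step labelled n, if any; f counts the thresholds left.
  greedy-chain : ∀ f n → f + n ≡ M + N → ∀ h {w u} → IsShuffle w → IsShuffle u → Alignment w u →
    PendingFrom n h w u → IncreasingChain n h w u
  greedy-chain zero n refl h shw shu al pending
    with refl ← PendingFrom-M+N⇒≡ pending al shw shu = [] , [] , tt
  greedy-chain (suc f) n f+n h {w} {u} shw shu al pending
    with any? (λ l → ¬? (l ∈? u) ×-dec (rank (delLabel h (predecessor w l) l) ℕ.≟ n)) w
  ... | yes deletable
    with l , l∈w , l∉u , L≡n ← find deletable
    with i , refl ← Alignment-dropped al l∈w l∉u
    with P , Q , refl ← ∈-∃++ l∈w
    rewrite AllPairs-predecessor Compat-irrefl P shw =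
    IncreasingChain-delete h P i Q shw L≡n
      (greedy-chain f (suc n) (trans (ℕ.+-suc f n) f+n) _ (AllPairs-delete P shw) shu
        (Alignment-delete P al l∉u) (PendingFrom-delete h n P i Q shw al pending L≡n))
  ... | no no-del with Fin.any? (λ k → ¬? (x k ∈? w) ×-dec (x k ∈? u) ×-dec (rank (x k) ℕ.≟ n))
  ...   | yes (k , k∉w , k∈u , k≡n) with P , Q , refl , al' ← Alignment-insert al k∉w k∈u =
    IncreasingChain-insert h P k Q shw sh' k≡n
      (greedy-chain f (suc n) (trans (ℕ.+-suc f n) f+n) h sh' shu al'
        (PendingFrom-insert h n P k Q sh' al k∈u pending k≡n))
    where
    sh' : IsShuffle (P ++ x k ∷ Q)
    sh' = shuffle-insert P k Q shw shu al'
  ...   | no no-ins = IncreasingChain-weaken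
    (greedy-chain f (suc n) (trans (ℕ.+-suc f n) f+n) h shw shu al
      (PendingFrom-skip pending no-del no-ins))

  PendingFrom-0 : ∀ {h w u} → PendingFrom 0 h w u
  PendingFrom-0 = record { deletions = λ _ _ → z≤n ; insertions = λ _ _ → z≤n }

  strictly-increasing-chain : ∀ h {w u} → IsShuffle w → IsShuffle u → Alignment w u →
    ∃ λ ws → Chain w u ws × StrictlyIncreasing (labelsFrom h w ws)
  strictly-increasing-chain h shw shu al
    with ws , ch , inc ← greedy-chain (M + N) 0 (ℕ.+-identityʳ (M + N)) h shw shu al PendingFrom-0 =
    ws , ch ,
    subst StrictlyIncreasing (sym (labelsFrom≡labels h ch)) (IncreasingFrom⇒StrictlyIncreasing 0 _ inc)

  -- Λ is an R*-labeling

  Sat⇒Chain : ∀ {w u ws} → Sat w u ws → ∃ λ ts → ws ≡ w ∷ ts × Chain w u ts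
  Sat⇒Chain done = [] , refl , []
  Sat⇒Chain (step c s) with ts , refl , ch ← Sat⇒Chain s = _ ∷ ts , refl , c ∷ ch

  Chain⇒Sat : ∀ {w u ts} → Chain w u ts → Sat w u (w ∷ ts)
  Chain⇒Sat []       = done
  Chain⇒Sat (c ∷ ch) = step c (Chain⇒Sat ch)

  _++ᶜ_ : ∀ {w v u ts ts'} → Chain w v ts → Chain v u ts' → Chain w u (ts ++ ts')
  []       ++ᶜ ch' = ch'
  (c ∷ ch) ++ᶜ ch' = c ∷ (ch ++ᶜ ch')

  ≤W-shuffle : ∀ {w u} → w ≤W u → IsShuffle w → IsShuffle u
  ≤W-shuffle ε                 sh = sh
  ≤W-shuffle ((_ , sh , _) ◅ s) _  = ≤W-shuffle s sh

  <W-shuffle : ∀ {w u} → w <W u → IsShuffle w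
  <W-shuffle (ε , w≢w)             = ⊥-elim (w≢w refl)
  <W-shuffle ((sh , _) ◅ _ , _) = sh

  labelsFrom-take : ∀ r h {w u u' ws ws'} → Chain w u ws → Chain w u' ws' → take r ws ≡ take r ws' →
    take r (labelsFrom h w ws) ≡ take r (labelsFrom h w ws')
  labelsFrom-take zero    h _        _         _  = refl
  labelsFrom-take (suc r) h []       []        _  = refl
  labelsFrom-take (suc r) h (c ∷ ch) (c' ∷ ch') eq
    with refl , eq′ ← List.∷-injective eq rewrite stepLabel-⋖ h c =
    cong (label h c ∷_) (labelsFrom-take r (history h c) ch ch' eq′)

  Λ-isCLabeling : IsCLabeling Λ
  Λ-isCLabeling c c' max max' r eq
    with _ , refl , ch ← Sat⇒Chain max | _ , refl , ch' ← Sat⇒Chain max' =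
    labelsFrom-take r [] ch ch' (List.∷-injectiveʳ eq)

  historyAfter : List (Fin N) → ∀ {w u ws} → Chain w u ws → List (Fin N)
  historyAfter h []       = h
  historyAfter h (c ∷ ch) = historyAfter (history h c) ch

  labelsFrom-++ : ∀ h {w v ts} (ch : Chain w v ts) vs →
    labelsFrom h w (ts ++ vs) ≡ labelsFrom h w ts ++ labelsFrom (historyAfter h ch) v vs
  labelsFrom-++ h []       vs = refl
  labelsFrom-++ h (c ∷ ch) vs rewrite stepLabel-⋖ h c =
    cong (label h c ∷_) (labelsFrom-++ (history h c) ch vs)

  length-labelsFrom : ∀ h {w u ws} → Chain w u ws → length (labelsFrom h w ws) ≡ length ws
  length-labelsFrom h ch = trans (cong length (labelsFrom≡labels h ch)) (length-labels h ch)

  Λ-segment : ∀ {wr u tP tq} (chP : Chain 0̂ wr tP) → Chain wr u tq → ∀ rest →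
    drop (length tP) (take (length tP + length tq) (Λ (0̂ ∷ (tP ++ tq) ++ rest))) ≡
    labelsFrom (historyAfter [] chP) wr tq
  Λ-segment {wr} {tP = tP} {tq} chP chq rest = begin
    drop (length tP) (take (length tP + length tq) (labelsFrom [] 0̂ ((tP ++ tq) ++ rest)))
      ≡⟨ cong (drop (length tP) ∘′ take (length tP + length tq)) split ⟩
    drop (length tP) (take (length tP + length tq) (X ++ Y ++ Z))
      ≡⟨ cong₂ (λ m n → drop m (take (m + n) (X ++ Y ++ Z)))
               (length-labelsFrom [] chP) (length-labelsFrom hP chq) ⟨
    drop (length X) (take (length X + length Y) (X ++ Y ++ Z))
      ≡⟨ drop-take-++ X Y Z ⟩
    Y ∎
    where
    open ≡-Reasoning
    hP : List (Fin N)
    hP = historyAfter [] chP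
    X Y Z : List Letter
    X = labelsFrom [] 0̂ tP
    Y = labelsFrom hP wr tq
    Z = labelsFrom (historyAfter hP chq) _ rest
    split : labelsFrom [] 0̂ ((tP ++ tq) ++ rest) ≡ X ++ Y ++ Z
    split = begin
      labelsFrom [] 0̂ ((tP ++ tq) ++ rest)   ≡⟨ cong (labelsFrom [] 0̂) (List.++-assoc tP tq rest) ⟩
      labelsFrom [] 0̂ (tP ++ tq ++ rest)     ≡⟨ labelsFrom-++ [] chP (tq ++ rest) ⟩
      X ++ labelsFrom hP wr (tq ++ rest)     ≡⟨ cong (X ++_) (labelsFrom-++ hP chq rest) ⟩
      X ++ Y ++ Z                            ∎

  IncreasingOn⇒ : ∀ {wr u tP tq} (chP : Chain 0̂ wr tP) → Chain wr u tq → IsShuffle u →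
    IncreasingOn Λ (0̂ ∷ tP) (wr ∷ tq) → StrictlyIncreasing (labelsFrom (historyAfter [] chP) wr tq)
  IncreasingOn⇒ {tP = tP} {tq} chP chq shu inc
    with rest , chr , _ ← strictly-increasing-chain [] shu 1̂-shuffle (Alignment-1̂ shu) =
    subst StrictlyIncreasing (Λ-segment chP chq rest)
      (inc (0̂ ∷ (tP ++ tq) ++ rest) (Chain⇒Sat ((chP ++ᶜ chq) ++ᶜ chr)) (rest , refl))

  IncreasingOn⇐ : ∀ {wr u tP tq} (chP : Chain 0̂ wr tP) → Chain wr u tq →
    StrictlyIncreasing (labelsFrom (historyAfter [] chP) wr tq) → IncreasingOn Λ (0̂ ∷ tP) (wr ∷ tq)
  IncreasingOn⇐ chP chq inc c _ (rest , refl) =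
    subst StrictlyIncreasing (sym (Λ-segment chP chq rest)) inc

  increasing-segment : ∀ {wr u tP} (chP : Chain 0̂ wr tP) → wr <W u →
    ∃ λ tq → Chain wr u tq × IncreasingOn Λ (0̂ ∷ tP) (wr ∷ tq)
  increasing-segment chP wr<u@(wr≤u , _)
    with tq , chq , inc ← strictly-increasing-chain (historyAfter [] chP) (<W-shuffle wr<u)
                            (≤W-shuffle wr≤u (<W-shuffle wr<u)) (≤W⇒Alignment wr≤u) =
    tq , chq , IncreasingOn⇐ chP chq inc

  increasing-segment-unique : ∀ {wr u tP tq tq'} (chP : Chain 0̂ wr tP) → wr <W u →
    Chain wr u tq → Chain wr u tq' →
    IncreasingOn Λ (0̂ ∷ tP) (wr ∷ tq) → IncreasingOn Λ (0̂ ∷ tP) (wr ∷ tq') → tq ≡ tq'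
  increasing-segment-unique chP wr<u@(wr≤u , _) chq chq' inc inc' =
    strictly-increasing-chain-unique _ shw chq chq'
      (IncreasingOn⇒ chP chq shu inc) (IncreasingOn⇒ chP chq' shu inc')
    where
    shw : IsShuffle _
    shw = <W-shuffle wr<u
    shu : IsShuffle _
    shu = ≤W-shuffle wr≤u shw

proposition3p4 : (M N : ℕ) → Shuffles.IsRStarLabeling M N (Shuffles.Λ M N)
proposition3p4 M N = Λ-isCLabeling , unique-increasing-chain
  where
  open Shuffles M N
  open RStar M N
  unique-increasing-chain : ∀ P wr u → Sat 0̂ wr P → wr <W u →
    ∃ λ q → (Sat wr u q × IncreasingOn Λ P q) × (∀ q' → Sat wr u q' → IncreasingOn Λ P q' → q' ≡ q)
  unique-increasing-chain P wr u satP wr<u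
    with tP , refl , chP ← Sat⇒Chain satP
    with tq , chq , inc ← increasing-segment chP wr<u =
    wr ∷ tq , (Chain⇒Sat chq , inc) , unique
    where
    unique : ∀ q' → Sat wr u q' → IncreasingOn Λ (0̂ ∷ tP) q' → q' ≡ wr ∷ tq
    unique q' satq' inc' with tq' , refl , chq' ← Sat⇒Chain satq' =
      cong (wr ∷_) (increasing-segment-unique chP wr<u chq' chq inc' inc)
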